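{- Let $\mathbf{f}_1,\dots,\mathbf{f}_n\in\mathbb{Q}(t)^m$ be parametric vectors with $\deg(\mathbf{f}_1)\le\dots\le\deg(\mathbf{f}_n)$, write $d_i=\deg(\mathbf{f}_i)$, and suppose the pilot vectors $\widetilde{\mathbf{f}_1},\dots,\widetilde{\mathbf{f}_n}\in\mathbb{Q}^m$ are linearly independent over $\mathbb{Q}$. Let $\mathbf{f}_1^*,\dots,\mathbf{f}_n^*$ and $\rho_{i,j}$ be the Gram–Schmidt vectors and coefficients of $\mathbf{f}_1,\dots,\mathbf{f}_n$ over $\mathbb{Q}(t)$, and let $(\widetilde{\mathbf{f}_1})^*,\dots,(\widetilde{\mathbf{f}_n})^*$ and $\mu_{i,j}$ be the Gram–Schmidt vectors and coefficients of $\widetilde{\mathbf{f}_1},\dots,\widetilde{\mathbf{f}_n}$ over $\mathbb{Q}$. Then: (1) $\deg(\mathbf{f}_i^*)=d_i$ for $1\le i\le n$; (2) $\lim_{t\to\infty}\rho_{i,j}(t)/t^{d_i-d_j}=\mu_{i,j}$ for $1\le j<i\le n$; (3) for each $1\le j<i\le n$, either $\rho_{i,j}(t)/t^{d_i-d_j}\ge\mu_{i,j}$ for all sufficiently large $t$, or $\rho_{i,j}(t)/t^{d_i-d_j}\le\mu_{i,j}$ for all sufficiently large $t$; (4) $\widetilde{(\mathbf{f}_i^*)}=(\widetilde{\mathbf{f}_i})^*$ for $1\le i\le n$.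
   Context: Gram–Schmidt without normalization: $\mathbf{v}_1^*=\mathbf{v}_1$, $\mathbf{v}_i^*=\mathbf{v}_i-\sum_{j<i}c_{i,j}\mathbf{v}_j^*$, $c_{i,j}=\langle\mathbf{v}_i,\mathbf{v}_j^*\rangle/\langle\mathbf{v}_j^*,\mathbf{v}_j^*\rangle$ (standard dot product); over $\mathbb{Q}(t)$ these are $\rho_{i,j}$, over $\mathbb{Q}$ they are $\mu_{i,j}$. For a nonzero rational function $r$, $\deg r$ is the degree of its numerator minus that of its denominator. For $\mathbf{f}=(f^{(1)},\dots,f^{(m)})\in\mathbb{Q}(t)^m$, $\deg(\mathbf{f})=\max_k\deg f^{(k)}$, and the pilot vector $\widetilde{\mathbf{f}}\in\mathbb{Q}^m$ is the vector whose $k$-th entry is the coefficient of $t^{\deg\mathbf{f}}$ in $f^{(k)}$ (for a rational function, the coefficient in its expansion at infinity, i.e. $\lim_{t\to\infty}f^{(k)}(t)/t^{\deg\mathbf{f}}$).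
   Formalization: In the limit of (2) and the inequalities for sufficiently large t in (3), the variable t ranges only over the rationals. -}

module Defs where

open import Data.Nat as ℕ using (ℕ; zero; suc)
open import Data.Integer as ℤ using (ℤ; +_)
open import Data.Rational as ℚ using (ℚ; 0ℚ; 1ℚ; _<_; _≤_; ∣_∣; _≟_; ≢-nonZero)
open import Data.Fin using (Fin)
open import Data.Vec as Vec using (Vec; []; _∷_; lookup; replicate; zipWith; foldr)
open import Data.List as List using (List; []; _∷_; [_]; _++_)
open import Data.Maybe using (Maybe; just; nothing)
open import Data.Product using (_×_; _,_; ∃)
open import Relation.Nullary using (yes; no)
open import Relation.Binary.PropositionalEquality using (_≡_)

-- Total inverse on ℚ (inverse of 0 is defined to be 0; it is never used
-- at 0 in a meaningful way).
invℚ : ℚ → ℚ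
invℚ q with q ≟ 0ℚ
... | yes _ = 0ℚ
... | no q≢0 = ℚ.1/_ q {{≢-nonZero q≢0}}

_^ℚ_ : ℚ → ℕ → ℚ
q ^ℚ zero  = 1ℚ
q ^ℚ suc k = q ℚ.* (q ^ℚ k)

-- Polynomials over ℚ: coefficient lists, constant term first

Poly : Set
Poly = List ℚ

addP : Poly → Poly → Poly
addP []       q        = q
addP (a ∷ p)  []       = a ∷ p
addP (a ∷ p)  (b ∷ q)  = (a ℚ.+ b) ∷ addP p q

negP : Poly → Poly
negP = List.map (λ a → ℚ.- a)

mulP : Poly → Poly → Poly
mulP []      q = []
mulP (a ∷ p) q = addP (List.map (a ℚ.*_) q) (0ℚ ∷ mulP p q)

evalP : Poly → ℚ → ℚ
evalP []      t = 0ℚ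
evalP (a ∷ p) t = a ℚ.+ t ℚ.* evalP p t

topP : Poly → Maybe (ℕ × ℚ)
topP []      = nothing
topP (a ∷ p) with topP p
... | just (k , c) = just (suc k , c)
... | nothing with a ≟ 0ℚ
...   | yes _ = nothing
...   | no  _ = just (zero , a)

-- Rational functions ℚ(t), represented as fractions num/den of
-- polynomials (den assumed nonzero for genuine elements of ℚ(t)).

record RatFun : Set where
  constructor _⁄_
  field
    num : Poly
    den : Poly
open RatFun public

WellFormed : RatFun → Set
WellFormed r = ∃ λ kc → topP (den r) ≡ just kc

0R : RatFun
0R = [] ⁄ [ 1ℚ ]

_+R_ : RatFun → RatFun → RatFun
(p ⁄ q) +R (r ⁄ s) = addP (mulP p s) (mulP r q) ⁄ mulP q s

_*R_ : RatFun → RatFun → RatFun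
(p ⁄ q) *R (r ⁄ s) = mulP p r ⁄ mulP q s

-R_ : RatFun → RatFun
-R (p ⁄ q) = negP p ⁄ q

-- total inverse (inverse of 0 is 0)
invR : RatFun → RatFun
invR (p ⁄ q) with topP p
... | nothing = 0R
... | just _  = q ⁄ p

-- degree: deg num − deg den; nothing (= −∞) for the zero function
degR : RatFun → Maybe ℤ
degR (p ⁄ q) with topP p | topP q
... | just (k , _) | just (l , _) = just ((+ k) ℤ.- (+ l))
... | _            | _            = nothing

-- leading coefficient (coefficient of t^deg in the expansion at ∞)
lcR : RatFun → ℚ
lcR (p ⁄ q) with topP p | topP q
... | just (_ , a) | just (_ , b) = a ℚ.* invℚ b
... | _            | _            = 0ℚ

-- value at a rational point t (meaningful whenever den(t) ≠ 0,
-- in particular for all sufficiently large t)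
evalR : RatFun → ℚ → ℚ
evalR (p ⁄ q) t = evalP p t ℚ.* invℚ (evalP q t)

maxD : Maybe ℤ → Maybe ℤ → Maybe ℤ
maxD nothing  e        = e
maxD (just a) nothing  = just a
maxD (just a) (just b) = just (a ℤ.⊔ b)

degV : ∀ {m} → Vec RatFun m → Maybe ℤ
degV = foldr _ (λ r d → maxD (degR r) d) nothing

-- coefficient of t^D in a rational function r (whose degree is ≤ D)
coeffAt : ℤ → RatFun → ℚ
coeffAt D r with degR r
... | nothing = 0ℚ
... | just e with e ℤ.≟ D
...   | yes _ = lcR r
...   | no  _ = 0ℚ

pilot : ∀ {m} → Vec RatFun m → Vec ℚ m
pilot {m} f with degV f
... | nothing = replicate m 0ℚ
... | just D  = Vec.map (coeffAt D) f

record FieldOps (A : Set) : Set where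
  field
    zeroF : A
    _⊕_   : A → A → A
    _⊗_   : A → A → A
    ⊖_    : A → A
    inv   : A → A

module GramSchmidt {A : Set} (F : FieldOps A) where
  open FieldOps F

  dot : ∀ {m} → Vec A m → Vec A m → A
  dot u v = foldr _ _⊕_ zeroF (zipWith _⊗_ u v)

  coeff : ∀ {m} → Vec A m → Vec A m → A
  coeff v w = dot v w ⊗ inv (dot w w)

  step : ∀ {m} → List (Vec A m) → Vec A m → Vec A m
  step ws v = List.foldl (λ acc w → zipWith (λ a b → a ⊕ (⊖ (coeff v w ⊗ b))) acc w) v ws

  go : ∀ {m k} → List (Vec A m) → Vec (Vec A m) k → Vec (Vec A m) k
  go ws []       = []
  go ws (v ∷ vs) = step ws v ∷ go (ws ++ [ step ws v ]) vs

  gsVecs : ∀ {m n} → Vec (Vec A m) n → Vec (Vec A m) n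
  gsVecs = go []

  gsCoeff : ∀ {m n} → Vec (Vec A m) n → Fin n → Fin n → A
  gsCoeff vs i j = coeff (lookup vs i) (lookup (gsVecs vs) j)

ℚops : FieldOps ℚ
ℚops = record { zeroF = 0ℚ ; _⊕_ = ℚ._+_ ; _⊗_ = ℚ._*_ ; ⊖_ = λ a → ℚ.- a ; inv = invℚ }

Rops : FieldOps RatFun
Rops = record { zeroF = 0R ; _⊕_ = _+R_ ; _⊗_ = _*R_ ; ⊖_ = -R_ ; inv = invR }

module GSℚ = GramSchmidt ℚops
module GSR = GramSchmidt Rops

linComb : ∀ {m n} → Vec ℚ n → Vec (Vec ℚ m) n → Vec ℚ m
linComb {m} cs vs = foldr _ (zipWith ℚ._+_) (replicate m 0ℚ)
                      (zipWith (λ c v → Vec.map (c ℚ.*_) v) cs vs)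

LinIndepℚ : ∀ {m n} → Vec (Vec ℚ m) n → Set
LinIndepℚ {m} {n} vs =
  ∀ (cs : Vec ℚ n) → linComb cs vs ≡ replicate m 0ℚ → cs ≡ replicate n 0ℚ

Eventually : (ℚ → Set) → Set
Eventually P = ∃ λ N → ∀ t → N < t → P t

LimAtInfty : (ℚ → ℚ) → ℚ → Set
LimAtInfty g L = ∀ ε → 0ℚ < ε → Eventually (λ t → ∣ g t ℚ.- L ∣ < ε)

-- Write a rational function as r = c·tᵉ + lower-order terms. Such leading terms add (when the
-- exponents agree, cancellation included) and multiply, and invert when c ≠ 0. So when
-- Gram–Schmidt runs over ℚ(t) on vectors of degrees dᵢ with pilot vectors f̃ᵢ, every quantity has
-- a leading term given by the same Gram–Schmidt recursion run over ℚ on the f̃ᵢ: ⟨fᵢ, fⱼ*⟩ leads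
-- with ⟨f̃ᵢ, (f̃ⱼ)*⟩·t^(dᵢ+dⱼ), and ⟨fⱼ*, fⱼ*⟩ with ⟨(f̃ⱼ)*, (f̃ⱼ)*⟩·t^(2dⱼ), whose coefficient is
-- nonzero because the f̃ᵢ are independent. Hence fᵢ* has degree dᵢ and pilot (f̃ᵢ)*, and
-- ρᵢⱼ = μᵢⱼ·t^(dᵢ−dⱼ) + lower-order terms. Finally ρᵢⱼ(t)/t^(dᵢ−dⱼ) − μᵢⱼ = R(t)/S(t) with
-- deg R < deg S, which tends to 0 and, like every such quotient, has an eventual sign.

module Submission where

open import Defs
open import Data.Nat as ℕ using (ℕ; zero; suc; z≤n; s≤s)
import Data.Nat.Properties as ℕP
open import Data.Integer as ℤ using (ℤ; +_; -[1+_]; +<+; -<+; ∣_∣)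
import Data.Integer.Properties as ℤP
open import Algebra.Properties.CommutativeSemigroup ℤP.+-commutativeSemigroup
  using (interchange; xy∙z≈xz∙y)
open import Data.Rational as ℚ using (ℚ; 0ℚ; 1ℚ; _≟_; _≤_; _<_)
import Data.Rational.Properties as ℚP
open import Data.Rational.Solver using (module +-*-Solver)
open import Data.List as List using (List; []; _∷_; [_]; _++_)
import Data.List.Properties as ListP
import Data.List.Relation.Binary.Pointwise as ListPW
open import Data.List.Relation.Unary.All as All using (All; []; _∷_)
import Data.List.Relation.Unary.All.Properties as AllP
open import Data.Vec as Vec using (Vec; []; _∷_; lookup; replicate)
import Data.Vec.Properties as VecP
open import Data.Vec.Relation.Binary.Pointwise.Inductive using (Pointwise; []; _∷_)
open import Data.Fin as Fin using (Fin; zero; suc)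
open import Data.Integer.Tactic.RingSolver using (solve-∀)
open import Data.Maybe using (Maybe; just; nothing)
open import Data.Maybe.Relation.Unary.All as MaybeAll using (just; nothing)
open import Data.Product using (_×_; _,_; Σ-syntax; proj₁; proj₂)
open import Data.Sum using (_⊎_; inj₁; inj₂)
open import Data.Empty using (⊥-elim)
open import Relation.Nullary using (yes; no)
open import Relation.Binary.Definitions using (tri<; tri≈; tri>)
open import Relation.Binary.PropositionalEquality hiding ([_])

open +-*-Solver

invℚ-inverseʳ : ∀ {c} → c ≢ 0ℚ → c ℚ.* invℚ c ≡ 1ℚ
invℚ-inverseʳ {c} c≢0 with c ≟ 0ℚ
... | yes c≡0 = ⊥-elim (c≢0 c≡0)
... | no c≢0′ = ℚP.*-inverseʳ c {{ℚ.≢-nonZero c≢0′}}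

invℚ-inverseˡ : ∀ {c} → c ≢ 0ℚ → invℚ c ℚ.* c ≡ 1ℚ
invℚ-inverseˡ {c} c≢0 = trans (ℚP.*-comm (invℚ c) c) (invℚ-inverseʳ c≢0)

module _ {p q : ℚ} (q≢0 : q ≢ 0ℚ) where

  p*q*q⁻¹≡p : p ℚ.* q ℚ.* invℚ q ≡ p
  p*q*q⁻¹≡p = begin
    p ℚ.* q ℚ.* invℚ q     ≡⟨ ℚP.*-assoc p q (invℚ q) ⟩
    p ℚ.* (q ℚ.* invℚ q)   ≡⟨ cong (p ℚ.*_) (invℚ-inverseʳ q≢0) ⟩
    p ℚ.* 1ℚ               ≡⟨ ℚP.*-identityʳ p ⟩
    p                      ∎
    where open ≡-Reasoning

  p*q⁻¹*q≡p : p ℚ.* invℚ q ℚ.* q ≡ p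
  p*q⁻¹*q≡p = begin
    p ℚ.* invℚ q ℚ.* q     ≡⟨ ℚP.*-assoc p (invℚ q) q ⟩
    p ℚ.* (invℚ q ℚ.* q)   ≡⟨ cong (p ℚ.*_) (invℚ-inverseˡ q≢0) ⟩
    p ℚ.* 1ℚ               ≡⟨ ℚP.*-identityʳ p ⟩
    p                      ∎
    where open ≡-Reasoning

  q⁻¹*[q*p]≡p : invℚ q ℚ.* (q ℚ.* p) ≡ p
  q⁻¹*[q*p]≡p = begin
    invℚ q ℚ.* (q ℚ.* p)   ≡⟨ ℚP.*-assoc (invℚ q) q p ⟨
    invℚ q ℚ.* q ℚ.* p     ≡⟨ cong (ℚ._* p) (invℚ-inverseˡ q≢0) ⟩
    1ℚ ℚ.* p               ≡⟨ ℚP.*-identityˡ p ⟩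
    p                      ∎
    where open ≡-Reasoning

p≢0∧q≢0⇒p*q≢0 : ∀ {p q} → p ≢ 0ℚ → q ≢ 0ℚ → p ℚ.* q ≢ 0ℚ
p≢0∧q≢0⇒p*q≢0 {p} {q} p≢0 q≢0 pq≡0 =
  p≢0 (trans (sym (p*q*q⁻¹≡p q≢0)) (trans (cong (ℚ._* invℚ q) pq≡0) (ℚP.*-zeroˡ (invℚ q))))

p*q≡0∧q≢0⇒p≡0 : ∀ {p q} → p ℚ.* q ≡ 0ℚ → q ≢ 0ℚ → p ≡ 0ℚ
p*q≡0∧q≢0⇒p≡0 {p} pq≡0 q≢0 with p ≟ 0ℚ
... | yes p≡0 = p≡0
... | no p≢0 = ⊥-elim (p≢0∧q≢0⇒p*q≢0 p≢0 q≢0 pq≡0)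

invℚ-unique : ∀ {x y} → x ≢ 0ℚ → x ℚ.* y ≡ 1ℚ → y ≡ invℚ x
invℚ-unique {x} {y} x≢0 xy≡1 =
  trans (sym (q⁻¹*[q*p]≡p x≢0)) (trans (cong (invℚ x ℚ.*_) xy≡1) (ℚP.*-identityʳ (invℚ x)))

invℚ-* : ∀ {x y} → x ≢ 0ℚ → y ≢ 0ℚ → invℚ (x ℚ.* y) ≡ invℚ x ℚ.* invℚ y
invℚ-* {x} {y} x≢0 y≢0 = sym (invℚ-unique (p≢0∧q≢0⇒p*q≢0 x≢0 y≢0) (begin
  (x ℚ.* y) ℚ.* (invℚ x ℚ.* invℚ y)
    ≡⟨ solve 4 (λ x y u v → (x :* y) :* (u :* v) := (x :* u) :* (y :* v)) refl x y (invℚ x) (invℚ y) ⟩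
  (x ℚ.* invℚ x) ℚ.* (y ℚ.* invℚ y)  ≡⟨ cong₂ ℚ._*_ (invℚ-inverseʳ x≢0) (invℚ-inverseʳ y≢0) ⟩
  1ℚ                                  ∎))
  where open ≡-Reasoning

invℚ-pos : ∀ {p} → 0ℚ < p → 0ℚ < invℚ p
invℚ-pos {p} 0<p with p ≟ 0ℚ
... | yes p≡0 = ⊥-elim (ℚP.<-irrefl (sym p≡0) 0<p)
... | no _    = ℚP.positive⁻¹ _ {{ℚP.1/pos⇒pos p {{ℚ.positive 0<p}}}}

invℚ-neg : ∀ {p} → p < 0ℚ → invℚ p < 0ℚ
invℚ-neg {p} p<0 with p ≟ 0ℚ
... | yes p≡0 = ⊥-elim (ℚP.<-irrefl p≡0 p<0)
... | no _    = ℚP.negative⁻¹ _ {{ℚP.1/neg⇒neg p {{ℚ.negative p<0}}}}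

∣invℚ∣-≢0 : ∀ {x} → x ≢ 0ℚ → ℚ.∣ invℚ x ∣ ≡ invℚ ℚ.∣ x ∣
∣invℚ∣-≢0 {x} x≢0 = invℚ-unique (λ ∣x∣≡0 → x≢0 (ℚP.∣p∣≡0⇒p≡0 x ∣x∣≡0))
  (trans (sym (ℚP.∣p*q∣≡∣p∣*∣q∣ x (invℚ x))) (cong ℚ.∣_∣ (invℚ-inverseʳ x≢0)))

∣invℚ∣ : ∀ x → ℚ.∣ invℚ x ∣ ≡ invℚ ℚ.∣ x ∣
∣invℚ∣ x with ℚP.<-cmp x 0ℚ
... | tri< x<0 _ _  = ∣invℚ∣-≢0 (ℚP.<⇒≢ x<0)
... | tri≈ _ refl _ = refl
... | tri> _ _ 0<x  = ∣invℚ∣-≢0 (≢-sym (ℚP.<⇒≢ 0<x))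

coeffP : Poly → ℕ → ℚ
coeffP []      j       = 0ℚ
coeffP (a ∷ p) zero    = a
coeffP (a ∷ p) (suc j) = coeffP p j

coeffPℤ : Poly → ℤ → ℚ
coeffPℤ p (+ n)    = coeffP p n
coeffPℤ p -[1+ n ] = 0ℚ

IsZeroP : Poly → Set
IsZeroP p = ∀ j → coeffP p j ≡ 0ℚ

VanishesFrom : Poly → ℕ → Set
VanishesFrom p n = ∀ j → n ℕ.≤ j → coeffP p j ≡ 0ℚ

VanishesAbove : Poly → ℤ → Set
VanishesAbove p z = ∀ j → z ℤ.< + j → coeffP p j ≡ 0ℚ

coeffP-addP : ∀ p q j → coeffP (addP p q) j ≡ coeffP p j ℚ.+ coeffP q j
coeffP-addP []      q       j       = sym (ℚP.+-identityˡ _)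
coeffP-addP (a ∷ p) []      j       = sym (ℚP.+-identityʳ _)
coeffP-addP (a ∷ p) (b ∷ q) zero    = refl
coeffP-addP (a ∷ p) (b ∷ q) (suc j) = coeffP-addP p q j

coeffP-negP : ∀ p j → coeffP (negP p) j ≡ ℚ.- coeffP p j
coeffP-negP []      j       = refl
coeffP-negP (a ∷ p) zero    = refl
coeffP-negP (a ∷ p) (suc j) = coeffP-negP p j

coeffP-scale : ∀ c p j → coeffP (List.map (c ℚ.*_) p) j ≡ c ℚ.* coeffP p j
coeffP-scale c []      j       = sym (ℚP.*-zeroʳ c)
coeffP-scale c (a ∷ p) zero    = refl
coeffP-scale c (a ∷ p) (suc j) = coeffP-scale c p j

coeffPℤ-addP : ∀ p q z → coeffPℤ (addP p q) z ≡ coeffPℤ p z ℚ.+ coeffPℤ q z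
coeffPℤ-addP p q (+ n)    = coeffP-addP p q n
coeffPℤ-addP p q -[1+ n ] = refl

coeffPℤ-negP : ∀ p z → coeffPℤ (negP p) z ≡ ℚ.- coeffPℤ p z
coeffPℤ-negP p (+ n)    = coeffP-negP p n
coeffPℤ-negP p -[1+ n ] = refl

coeffPℤ-scale : ∀ c p z → coeffPℤ (List.map (c ℚ.*_) p) z ≡ c ℚ.* coeffPℤ p z
coeffPℤ-scale c p (+ n)    = coeffP-scale c p n
coeffPℤ-scale c p -[1+ n ] = sym (ℚP.*-zeroʳ c)

coeffP-mulP-∷ : ∀ a p q j → coeffP (mulP (a ∷ p) q) j ≡ a ℚ.* coeffP q j ℚ.+ coeffP (0ℚ ∷ mulP p q) j
coeffP-mulP-∷ a p q j = trans (coeffP-addP (List.map (a ℚ.*_) q) _ j) (cong (ℚ._+ _) (coeffP-scale a q j))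

mulP-zeroˡ : ∀ p q → IsZeroP p → IsZeroP (mulP p q)
mulP-zeroˡ []      q p≡0 j = refl
mulP-zeroˡ (a ∷ p) q p≡0 j = begin
  coeffP (mulP (a ∷ p) q) j                     ≡⟨ coeffP-mulP-∷ a p q j ⟩
  a ℚ.* coeffP q j ℚ.+ coeffP (0ℚ ∷ mulP p q) j ≡⟨ cong₂ ℚ._+_ (cong (ℚ._* coeffP q j) (p≡0 zero)) (tail≡0 j) ⟩
  0ℚ ℚ.* coeffP q j ℚ.+ 0ℚ                      ≡⟨ solve 1 (λ x → con 0ℚ :* x :+ con 0ℚ := con 0ℚ) refl (coeffP q j) ⟩
  0ℚ                                            ∎
  where
  open ≡-Reasoning
  tail≡0 : IsZeroP (0ℚ ∷ mulP p q)
  tail≡0 zero    = refl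
  tail≡0 (suc j) = mulP-zeroˡ p q (λ i → p≡0 (suc i)) j

mulP-zeroʳ : ∀ p q → IsZeroP q → IsZeroP (mulP p q)
mulP-zeroʳ []      q q≡0 j = refl
mulP-zeroʳ (a ∷ p) q q≡0 j = begin
  coeffP (mulP (a ∷ p) q) j                     ≡⟨ coeffP-mulP-∷ a p q j ⟩
  a ℚ.* coeffP q j ℚ.+ coeffP (0ℚ ∷ mulP p q) j ≡⟨ cong₂ ℚ._+_ (cong (a ℚ.*_) (q≡0 j)) (tail≡0 j) ⟩
  a ℚ.* 0ℚ ℚ.+ 0ℚ                               ≡⟨ solve 1 (λ a → a :* con 0ℚ :+ con 0ℚ := con 0ℚ) refl a ⟩
  0ℚ                                            ∎
  where
  open ≡-Reasoning
  tail≡0 : IsZeroP (0ℚ ∷ mulP p q)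
  tail≡0 zero    = refl
  tail≡0 (suc j) = mulP-zeroʳ p q q≡0 j

mulP-top : ∀ p q a b → VanishesFrom p (suc a) → VanishesFrom q (suc b)
         → VanishesFrom (mulP p q) (suc (a ℕ.+ b)) × coeffP (mulP p q) (a ℕ.+ b) ≡ coeffP p a ℚ.* coeffP q b
mulP-top []      q a       b _  _  = (λ _ _ → refl) , sym (ℚP.*-zeroˡ (coeffP q b))
mulP-top (x ∷ p) q zero    b vp vq = vanishes , top
  where
  tail≡0 : IsZeroP (0ℚ ∷ mulP p q)
  tail≡0 zero    = refl
  tail≡0 (suc j) = mulP-zeroˡ p q (λ j → vp (suc j) (s≤s z≤n)) j
  coeff≡ : ∀ j → coeffP (mulP (x ∷ p) q) j ≡ x ℚ.* coeffP q j
  coeff≡ j = trans (coeffP-mulP-∷ x p q j) (trans (cong (x ℚ.* coeffP q j ℚ.+_) (tail≡0 j)) (ℚP.+-identityʳ _))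
  vanishes : VanishesFrom (mulP (x ∷ p) q) (suc b)
  vanishes j b<j = trans (coeff≡ j) (trans (cong (x ℚ.*_) (vq j b<j)) (ℚP.*-zeroʳ x))
  top : coeffP (mulP (x ∷ p) q) b ≡ x ℚ.* coeffP q b
  top = coeff≡ b
mulP-top (x ∷ p) q (suc a) b vp vq = vanishes , top
  where
  ih = mulP-top p q a b (λ j a<j → vp (suc j) (s≤s a<j)) vq
  b<1+ : ∀ {j} → a ℕ.+ b ℕ.≤ j → b ℕ.< suc j
  b<1+ le = s≤s (ℕP.≤-trans (ℕP.m≤n+m b a) le)
  coeff≡ : ∀ j → b ℕ.< suc j → coeffP (mulP (x ∷ p) q) (suc j) ≡ coeffP (mulP p q) j
  coeff≡ j b≤j = begin
    coeffP (mulP (x ∷ p) q) (suc j)               ≡⟨ coeffP-mulP-∷ x p q (suc j) ⟩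
    x ℚ.* coeffP q (suc j) ℚ.+ coeffP (mulP p q) j ≡⟨ cong (λ c → x ℚ.* c ℚ.+ coeffP (mulP p q) j) (vq (suc j) b≤j) ⟩
    x ℚ.* 0ℚ ℚ.+ coeffP (mulP p q) j               ≡⟨ solve 2 (λ x c → x :* con 0ℚ :+ c := c) refl x _ ⟩
    coeffP (mulP p q) j                           ∎
    where open ≡-Reasoning
  vanishes : VanishesFrom (mulP (x ∷ p) q) (suc (suc a ℕ.+ b))
  vanishes (suc j) (s≤s le) = trans (coeff≡ j (b<1+ (ℕP.≤-trans (ℕP.n≤1+n _) le))) (proj₁ ih j le)
  top : coeffP (mulP (x ∷ p) q) (suc (a ℕ.+ b)) ≡ coeffP p a ℚ.* coeffP q b
  top = trans (coeff≡ (a ℕ.+ b) (b<1+ ℕP.≤-refl)) (proj₂ ih)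

-- p = a·tᶻ + lower-order terms; a = 0 is allowed.
LeadP : Poly → ℤ → ℚ → Set
LeadP p z a = coeffPℤ p z ≡ a × VanishesAbove p z

data TopSpec (p : Poly) : Maybe (ℕ × ℚ) → Set where
  zeroP : IsZeroP p → TopSpec p nothing
  top   : ∀ {k c} → LeadP p (+ k) c → c ≢ 0ℚ → TopSpec p (just (k , c))

topP-spec : ∀ p → TopSpec p (topP p)
topP-spec []      = zeroP (λ _ → refl)
topP-spec (a ∷ p) with topP p | topP-spec p
... | just (k , c) | top (c≡ , above) c≢0 = top (c≡ , above′) c≢0
  where
  above′ : VanishesAbove (a ∷ p) (+ suc k)
  above′ (suc j) (+<+ (s≤s k<j)) = above j (+<+ k<j)
... | nothing | zeroP p≡0 with a ≟ 0ℚ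
...   | yes a≡0 = zeroP λ { zero → a≡0 ; (suc j) → p≡0 j }
...   | no  a≢0 = top (refl , λ { zero (+<+ ()) ; (suc j) _ → p≡0 j }) a≢0

topSpec-unique : ∀ {p m m′} → TopSpec p m → TopSpec p m′ → m ≡ m′
topSpec-unique (zeroP _)           (zeroP _)            = refl
topSpec-unique (zeroP p≡0)         (top (c≡ , _) c≢0)   = ⊥-elim (c≢0 (trans (sym c≡) (p≡0 _)))
topSpec-unique (top (c≡ , _) c≢0)  (zeroP p≡0)          = ⊥-elim (c≢0 (trans (sym c≡) (p≡0 _)))
topSpec-unique (top {k} (c≡ , above) c≢0) (top {k′} (c≡′ , above′) c≢0′) with ℕP.<-cmp k k′
... | tri< k<k′ _ _ = ⊥-elim (c≢0′ (trans (sym c≡′) (above k′ (+<+ k<k′))))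
... | tri> _ _ k>k′ = ⊥-elim (c≢0 (trans (sym c≡) (above′ k (+<+ k>k′))))
... | tri≈ _ refl _ = cong (λ c → just (k , c)) (trans (sym c≡) c≡′)

leadP⇒topP : ∀ p {k c} → LeadP p (+ k) c → c ≢ 0ℚ → topP p ≡ just (k , c)
leadP⇒topP p l c≢0 = topSpec-unique (topP-spec p) (top l c≢0)

topP⇒leadP : ∀ p {k c} → topP p ≡ just (k , c) → LeadP p (+ k) c × c ≢ 0ℚ
topP⇒leadP p eq with subst (TopSpec p) eq (topP-spec p)
... | top l c≢0 = l , c≢0

topP⇒isZeroP : ∀ p → topP p ≡ nothing → IsZeroP p
topP⇒isZeroP p eq with subst (TopSpec p) eq (topP-spec p)
... | zeroP p≡0 = p≡0

leadP-zero : ∀ {p} z → IsZeroP p → LeadP p z 0ℚ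
leadP-zero (+ n)    p≡0 = p≡0 n , λ j _ → p≡0 j
leadP-zero -[1+ n ] p≡0 = refl  , λ j _ → p≡0 j

leadP-weaken : ∀ {p z a} w → LeadP p z a → z ℤ.< w → LeadP p w 0ℚ
leadP-weaken (+ n)    (_ , above) z<w = above n z<w , λ j w<j → above j (ℤP.<-trans z<w w<j)
leadP-weaken -[1+ n ] (_ , above) z<w = refl        , λ j w<j → above j (ℤP.<-trans z<w w<j)

leadP-addP : ∀ {p q z a b} → LeadP p z a → LeadP q z b → LeadP (addP p q) z (a ℚ.+ b)
leadP-addP {p} {q} {z} (a≡ , vp) (b≡ , vq) =
  trans (coeffPℤ-addP p q z) (cong₂ ℚ._+_ a≡ b≡) ,
  λ j z<j → trans (coeffP-addP p q j) (trans (cong₂ ℚ._+_ (vp j z<j) (vq j z<j)) (ℚP.+-identityˡ 0ℚ))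

leadP-negP : ∀ {p z a} → LeadP p z a → LeadP (negP p) z (ℚ.- a)
leadP-negP {p} {z} (a≡ , vp) =
  trans (coeffPℤ-negP p z) (cong ℚ.-_ a≡) , λ j z<j → trans (coeffP-negP p j) (cong ℚ.-_ (vp j z<j))

leadP-scale : ∀ c {p z a} → LeadP p z a → LeadP (List.map (c ℚ.*_) p) z (c ℚ.* a)
leadP-scale c {p} {z} (a≡ , vp) =
  trans (coeffPℤ-scale c p z) (cong (c ℚ.*_) a≡) ,
  λ j z<j → trans (coeffP-scale c p j) (trans (cong (c ℚ.*_) (vp j z<j)) (ℚP.*-zeroʳ c))

leadP-mulP : ∀ p q {z w a b} → LeadP p z a → LeadP q w b → LeadP (mulP p q) (z ℤ.+ w) (a ℚ.* b)
leadP-mulP p q {+ m} {+ n} (a≡ , vp) (b≡ , vq) =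
  trans (proj₂ product) (cong₂ ℚ._*_ a≡ b≡) , λ { j (+<+ m+n<j) → proj₁ product j m+n<j }
  where product = mulP-top p q m n (λ j m<j → vp j (+<+ m<j)) (λ j n<j → vq j (+<+ n<j))
leadP-mulP p q { -[1+ m ]} {b = b} (refl , vp) _ =
  subst (LeadP (mulP p q) _) (sym (ℚP.*-zeroˡ b)) (leadP-zero _ (mulP-zeroˡ p q (λ j → vp j -<+)))
leadP-mulP p q {+ m} { -[1+ n ]} {a = a} _ (refl , vq) =
  subst (LeadP (mulP p q) _) (sym (ℚP.*-zeroʳ a)) (leadP-zero _ (mulP-zeroʳ p q (λ j → vq j -<+)))

topP-mulP : ∀ p q {k l a b} → topP p ≡ just (k , a) → topP q ≡ just (l , b)
          → topP (mulP p q) ≡ just (k ℕ.+ l , a ℚ.* b)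
topP-mulP p q tp tq with topP⇒leadP p tp | topP⇒leadP q tq
... | leadp , a≢0 | leadq , b≢0 = leadP⇒topP (mulP p q) (leadP-mulP p q leadp leadq) (p≢0∧q≢0⇒p*q≢0 a≢0 b≢0)

i-j+j≡i : ∀ i j → i ℤ.- j ℤ.+ j ≡ i
i-j+j≡i = solve-∀

i+j-j≡i : ∀ i j → i ℤ.+ j ℤ.- j ≡ i
i+j-j≡i = solve-∀

i-j<k⇒i<k+j : ∀ {i j k} → i ℤ.- j ℤ.< k → i ℤ.< k ℤ.+ j
i-j<k⇒i<k+j {i} {j} {k} lt = subst (ℤ._< k ℤ.+ j) (i-j+j≡i i j) (ℤP.+-monoˡ-< j lt)

i<k+j⇒i-j<k : ∀ {i j k} → i ℤ.< k ℤ.+ j → i ℤ.- j ℤ.< k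
i<k+j⇒i-j<k {i} {j} {k} lt = subst (i ℤ.- j ℤ.<_) (i+j-j≡i k j) (ℤP.+-monoˡ-< (ℤ.- j) lt)

-i+[i+j]≡j : ∀ i j → ℤ.- i ℤ.+ (i ℤ.+ j) ≡ j
-i+[i+j]≡j = solve-∀

-- r = c·tᵉ + lower-order terms, read off the representation num/den:
-- den has top term b·tˡ and num has coefficient c·b at tᵉ⁺ˡ.
record LeadR (r : RatFun) (e : ℤ) (c : ℚ) : Set where
  constructor leadR
  field
    denDeg   : ℕ
    denTop   : ℚ
    den-top  : topP (den r) ≡ just (denDeg , denTop)
    num-lead : LeadP (num r) (e ℤ.+ + denDeg) (c ℚ.* denTop)

leadR-0R : ∀ e → LeadR 0R e 0ℚ
leadR-0R e = leadR 0 1ℚ refl (leadP-zero _ (λ _ → refl))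

leadR-+R : ∀ {r s e c d} → LeadR r e c → LeadR s e d → LeadR (r +R s) e (c ℚ.+ d)
leadR-+R {p ⁄ q} {P ⁄ Q} {e} {c} {d} (leadR l b tq lp) (leadR L B tQ lP) =
  leadR (l ℕ.+ L) (b ℚ.* B) (topP-mulP q Q tq tQ) (subst₂ (LeadP _) index₂ coeff (leadP-addP pQ Pq))
  where
  index₁ : (e ℤ.+ + l) ℤ.+ + L ≡ (e ℤ.+ + L) ℤ.+ + l
  index₁ = xy∙z≈xz∙y e (+ l) (+ L)
  index₂ : (e ℤ.+ + L) ℤ.+ + l ≡ e ℤ.+ + (l ℕ.+ L)
  index₂ = trans (sym index₁) (ℤP.+-assoc e (+ l) (+ L))
  pQ = subst (λ z → LeadP (mulP p Q) z _) index₁ (leadP-mulP p Q lp (proj₁ (topP⇒leadP Q tQ)))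
  Pq = leadP-mulP P q lP (proj₁ (topP⇒leadP q tq))
  coeff : (c ℚ.* b) ℚ.* B ℚ.+ (d ℚ.* B) ℚ.* b ≡ (c ℚ.+ d) ℚ.* (b ℚ.* B)
  coeff = solve 4 (λ c d b B → (c :* b) :* B :+ (d :* B) :* b := (c :+ d) :* (b :* B)) refl c d b B

leadR-*R : ∀ {r s e f c d} → LeadR r e c → LeadR s f d → LeadR (r *R s) (e ℤ.+ f) (c ℚ.* d)
leadR-*R {p ⁄ q} {P ⁄ Q} {e} {f} {c} {d} (leadR l b tq lp) (leadR L B tQ lP) =
  leadR (l ℕ.+ L) (b ℚ.* B) (topP-mulP q Q tq tQ)
        (subst₂ (LeadP _) (interchange e (+ l) f (+ L)) coeff (leadP-mulP p P lp lP))
  where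
  coeff : (c ℚ.* b) ℚ.* (d ℚ.* B) ≡ (c ℚ.* d) ℚ.* (b ℚ.* B)
  coeff = solve 4 (λ c d b B → (c :* b) :* (d :* B) := (c :* d) :* (b :* B)) refl c d b B

leadR-negR : ∀ {r e c} → LeadR r e c → LeadR (-R r) e (ℚ.- c)
leadR-negR {c = c} (leadR l b tq lp) = leadR l b tq (subst (LeadP _ _) (ℚP.neg-distribˡ-* c b) (leadP-negP lp))

invR-⁄ : ∀ {p q kc} → topP p ≡ just kc → invR (p ⁄ q) ≡ q ⁄ p
invR-⁄ tp rewrite tp = refl

leadR-invR : ∀ {r e c} → LeadR r e c → c ≢ 0ℚ → LeadR (invR r) (ℤ.- e) (invℚ c)
leadR-invR {p ⁄ q} {e} {c} (leadR l b tq lp) c≢0 with e ℤ.+ + l in e+l≡ | lp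
... | -[1+ n ] | cb≡0 , _ = ⊥-elim (cb≢0 (sym cb≡0))
  where cb≢0 = p≢0∧q≢0⇒p*q≢0 c≢0 (proj₂ (topP⇒leadP q tq))
... | + k      | lp′ = subst (λ r → LeadR r (ℤ.- e) (invℚ c)) (sym (invR-⁄ tp)) (leadR k (c ℚ.* b) tp lq)
  where
  tp = leadP⇒topP p lp′ (p≢0∧q≢0⇒p*q≢0 c≢0 (proj₂ (topP⇒leadP q tq)))
  index : + l ≡ ℤ.- e ℤ.+ + k
  index = trans (sym (-i+[i+j]≡j e (+ l))) (cong (ℤ._+_ (ℤ.- e)) e+l≡)
  lq = subst₂ (LeadP q) index (sym (q⁻¹*[q*p]≡p c≢0)) (proj₁ (topP⇒leadP q tq))

_≤ᵈ_ : Maybe ℤ → ℤ → Set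
d ≤ᵈ D = MaybeAll.All (ℤ._≤ D) d

module _ (p q : Poly) where

  degR-⁄-zero : topP p ≡ nothing → degR (p ⁄ q) ≡ nothing
  degR-⁄-zero tp rewrite tp = refl

  degR-⁄ : ∀ {k a l b} → topP p ≡ just (k , a) → topP q ≡ just (l , b) → degR (p ⁄ q) ≡ just (+ k ℤ.- + l)
  degR-⁄ tp tq rewrite tp | tq = refl

  lcR-⁄ : ∀ {k a l b} → topP p ≡ just (k , a) → topP q ≡ just (l , b) → lcR (p ⁄ q) ≡ a ℚ.* invℚ b
  lcR-⁄ tp tq rewrite tp | tq = refl

module _ (r : RatFun) (D : ℤ) where

  coeffAt-zero : degR r ≡ nothing → coeffAt D r ≡ 0ℚ
  coeffAt-zero deg≡ rewrite deg≡ = refl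

  coeffAt-≡ : ∀ {e} → degR r ≡ just e → e ≡ D → coeffAt D r ≡ lcR r
  coeffAt-≡ {e} deg≡ e≡D rewrite deg≡ with e ℤ.≟ D
  ... | yes _   = refl
  ... | no e≢D = ⊥-elim (e≢D e≡D)

  coeffAt-≢ : ∀ {e} → degR r ≡ just e → e ≢ D → coeffAt D r ≡ 0ℚ
  coeffAt-≢ {e} deg≡ e≢D rewrite deg≡ with e ℤ.≟ D
  ... | yes e≡D = ⊥-elim (e≢D e≡D)
  ... | no _    = refl

leadR-coeffAt : ∀ r D → WellFormed r → degR r ≤ᵈ D → LeadR r D (coeffAt D r)
leadR-coeffAt (p ⁄ q) D ((l , b) , tq) deg≤ = byTop (topP p) refl
  where
  b≢0 = proj₂ (topP⇒leadP q tq)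
  byTop : ∀ m → topP p ≡ m → LeadR (p ⁄ q) D (coeffAt D (p ⁄ q))
  byTop nothing tp = subst (LeadR _ D) (sym (coeffAt-zero (p ⁄ q) D (degR-⁄-zero p q tp)))
    (leadR l b tq (subst (LeadP p _) (sym (ℚP.*-zeroˡ b)) (leadP-zero _ (topP⇒isZeroP p tp))))
  byTop (just (k , a)) tp with + k ℤ.- + l ℤ.≟ D
  ... | yes k-l≡D = subst (LeadR _ D) (sym (trans (coeffAt-≡ (p ⁄ q) D deg≡ k-l≡D) (lcR-⁄ p q tp tq)))
    (leadR l b tq (subst₂ (LeadP p) index (sym (p*q⁻¹*q≡p b≢0)) (proj₁ (topP⇒leadP p tp))))
    where
    deg≡ = degR-⁄ p q tp tq
    index : + k ≡ D ℤ.+ + l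
    index = trans (sym (i-j+j≡i (+ k) (+ l))) (cong (ℤ._+ + l) k-l≡D)
  ... | no k-l≢D = subst (LeadR _ D) (sym (coeffAt-≢ (p ⁄ q) D deg≡ k-l≢D))
    (leadR l b tq (subst (LeadP p _) (sym (ℚP.*-zeroˡ b)) (leadP-weaken _ (proj₁ (topP⇒leadP p tp)) k<D+l)))
    where
    deg≡ = degR-⁄ p q tp tq
    k<D+l : + k ℤ.< D ℤ.+ + l
    k<D+l with subst (_≤ᵈ D) deg≡ deg≤
    ... | just k-l≤D = i-j<k⇒i<k+j (ℤP.≤∧≢⇒< k-l≤D k-l≢D)

record DegreeData (r : RatFun) (e : ℤ) (c : ℚ) : Set where
  field
    degR≤    : degR r ≤ᵈ e
    coeffAt≡ : coeffAt e r ≡ c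
    degR≡    : c ≢ 0ℚ → degR r ≡ just e

leadR⇒degreeData : ∀ {r e c} → LeadR r e c → DegreeData r e c
leadR⇒degreeData {p ⁄ q} {e} {c} (leadR l b tq (c≡ , above)) = byTop (topP p) refl
  where
  b≢0 = proj₂ (topP⇒leadP q tq)
  byTop : ∀ m → topP p ≡ m → DegreeData (p ⁄ q) e c
  byTop nothing tp = record
    { degR≤    = subst (_≤ᵈ e) (sym deg≡) nothing
    ; coeffAt≡ = trans (coeffAt-zero (p ⁄ q) e deg≡) (sym c≡0)
    ; degR≡    = λ c≢0 → ⊥-elim (c≢0 c≡0)
    }
    where
    deg≡ = degR-⁄-zero p q tp
    c≡0 = p*q≡0∧q≢0⇒p≡0 (trans (sym c≡) (proj₁ (leadP-zero {p} (e ℤ.+ + l) (topP⇒isZeroP p tp)))) b≢0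
  byTop (just (k , a)) tp with topP⇒leadP p tp | ℤP.<-cmp (+ k) (e ℤ.+ + l)
  ... | lead-p , _ | tri< k<e+l _ _ = record
    { degR≤    = subst (_≤ᵈ e) (sym deg≡) (just (ℤP.<⇒≤ k-l<e))
    ; coeffAt≡ = trans (coeffAt-≢ (p ⁄ q) e deg≡ (ℤP.<⇒≢ k-l<e)) (sym c≡0)
    ; degR≡    = λ c≢0 → ⊥-elim (c≢0 c≡0)
    }
    where
    deg≡ = degR-⁄ p q tp tq
    k-l<e = i<k+j⇒i-j<k k<e+l
    c≡0 = p*q≡0∧q≢0⇒p≡0 (trans (sym c≡) (proj₁ (leadP-weaken _ lead-p k<e+l))) b≢0
  ... | (a≡ , _) , a≢0 | tri> _ _ e+l<k = ⊥-elim (a≢0 (trans (sym a≡) (above k e+l<k)))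
  ... | (a≡ , _) , _   | tri≈ _ k≡e+l _ = record
    { degR≤    = subst (_≤ᵈ e) (sym deg≡) (just (ℤP.≤-reflexive k-l≡e))
    ; coeffAt≡ = trans (coeffAt-≡ (p ⁄ q) e deg≡ k-l≡e)
                       (trans (lcR-⁄ p q tp tq) (trans (cong (ℚ._* invℚ b) a≡cb) (p*q*q⁻¹≡p b≢0)))
    ; degR≡    = λ _ → trans deg≡ (cong just k-l≡e)
    }
    where
    deg≡ = degR-⁄ p q tp tq
    k-l≡e : + k ℤ.- + l ≡ e
    k-l≡e = trans (cong (ℤ._- + l) k≡e+l) (i+j-j≡i e (+ l))
    a≡cb : a ≡ c ℚ.* b
    a≡cb = trans (sym a≡) (trans (cong (coeffPℤ p) k≡e+l) c≡)

LeadV : ∀ {m} → Vec RatFun m → ℤ → Vec ℚ m → Set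
LeadV v e cs = Pointwise (λ r c → LeadR r e c) v cs

maxD-≤ᵈ⁻ : ∀ a b {D} → maxD a b ≤ᵈ D → a ≤ᵈ D × b ≤ᵈ D
maxD-≤ᵈ⁻ nothing  b        b≤D           = nothing , b≤D
maxD-≤ᵈ⁻ (just a) nothing  a≤D           = a≤D , nothing
maxD-≤ᵈ⁻ (just a) (just b) (just a⊔b≤D) = just (ℤP.i⊔j≤k⇒i≤k a b a⊔b≤D) , just (ℤP.i⊔j≤k⇒j≤k a b a⊔b≤D)

maxD-lub : ∀ {a b D} → a ≤ᵈ D → b ≤ᵈ D → maxD a b ≤ᵈ D
maxD-lub nothing    b≤D        = b≤D
maxD-lub (just a≤D) nothing    = just a≤D
maxD-lub (just a≤D) (just b≤D) = just (ℤP.⊔-lub a≤D b≤D)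

maxD-justˡ : ∀ {b e} → b ≤ᵈ e → maxD (just e) b ≡ just e
maxD-justˡ nothing    = refl
maxD-justˡ (just b≤e) = cong just (ℤP.i≥j⇒i⊔j≡i b≤e)

maxD-justʳ : ∀ {a e} → a ≤ᵈ e → maxD a (just e) ≡ just e
maxD-justʳ nothing    = refl
maxD-justʳ (just a≤e) = cong just (ℤP.i≤j⇒i⊔j≡j a≤e)

pilot-degV : ∀ {m} (v : Vec RatFun m) {D} → degV v ≡ just D → pilot v ≡ Vec.map (coeffAt D) v
pilot-degV v deg≡ rewrite deg≡ = refl

leadV-coeffAt : ∀ {m} (v : Vec RatFun m) D → (∀ k → WellFormed (lookup v k)) → degV v ≤ᵈ D
              → LeadV v D (Vec.map (coeffAt D) v)
leadV-coeffAt []      D wf deg≤ = []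
leadV-coeffAt (r ∷ v) D wf deg≤ with maxD-≤ᵈ⁻ (degR r) (degV v) deg≤
... | r≤D , v≤D = leadR-coeffAt r D (wf zero) r≤D ∷ leadV-coeffAt v D (λ k → wf (suc k)) v≤D

degV⇒leadV : ∀ {m} (v : Vec RatFun m) {D} → (∀ k → WellFormed (lookup v k)) → degV v ≡ just D
           → LeadV v D (pilot v)
degV⇒leadV v {D} wf deg≡ = subst (LeadV v D) (sym (pilot-degV v deg≡))
  (leadV-coeffAt v D wf (subst (_≤ᵈ D) (sym deg≡) (just ℤP.≤-refl)))

leadV⇒degV≤ : ∀ {m} {v : Vec RatFun m} {e cs} → LeadV v e cs → degV v ≤ᵈ e
leadV⇒degV≤ []       = nothing
leadV⇒degV≤ (r ∷ rs) = maxD-lub (DegreeData.degR≤ (leadR⇒degreeData r)) (leadV⇒degV≤ rs)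

leadV⇒degV : ∀ {m} {v : Vec RatFun m} {e cs} → LeadV v e cs → cs ≢ replicate m 0ℚ → degV v ≡ just e
leadV⇒degV []                                 cs≢0 = ⊥-elim (cs≢0 refl)
leadV⇒degV {v = r ∷ v} {cs = c ∷ cs} (lr ∷ lv) cs≢0 with c ≟ 0ℚ
... | yes c≡0 = trans (cong (maxD (degR r)) (leadV⇒degV lv (λ cs≡0 → cs≢0 (cong₂ _∷_ c≡0 cs≡0))))
                      (maxD-justʳ (DegreeData.degR≤ (leadR⇒degreeData lr)))
... | no c≢0  = trans (cong (λ d → maxD d (degV v)) (DegreeData.degR≡ (leadR⇒degreeData lr) c≢0))
                      (maxD-justˡ (leadV⇒degV≤ lv))

leadV⇒map-coeffAt : ∀ {m} {v : Vec RatFun m} {e cs} → LeadV v e cs → Vec.map (coeffAt e) v ≡ cs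
leadV⇒map-coeffAt []        = refl
leadV⇒map-coeffAt (lr ∷ lv) = cong₂ _∷_ (DegreeData.coeffAt≡ (leadR⇒degreeData lr)) (leadV⇒map-coeffAt lv)

leadV⇒pilot : ∀ {m} {v : Vec RatFun m} {e cs} → LeadV v e cs → cs ≢ replicate m 0ℚ → pilot v ≡ cs
leadV⇒pilot {v = v} lv cs≢0 = trans (pilot-degV v (leadV⇒degV lv cs≢0)) (leadV⇒map-coeffAt lv)

-- Gram–Schmidt commutes with taking leading terms

leadR-dot : ∀ {m} {u v : Vec RatFun m} {e f cs ds} → LeadV u e cs → LeadV v f ds
          → LeadR (GSR.dot u v) (e ℤ.+ f) (GSℚ.dot cs ds)
leadR-dot {e = e} {f} []        []        = leadR-0R (e ℤ.+ f)
leadR-dot         (lr ∷ lu) (ls ∷ lv) = leadR-+R (leadR-*R lr ls) (leadR-dot lu lv)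

leadR-coeff : ∀ {m} {v w : Vec RatFun m} {e d v′ w′} → LeadV v e v′ → LeadV w d w′ → GSℚ.dot w′ w′ ≢ 0ℚ
            → LeadR (GSR.coeff v w) (e ℤ.- d) (GSℚ.coeff v′ w′)
leadR-coeff {e = e} {d} lv lw w′≢0 =
  subst (λ z → LeadR _ z _) (index e d) (leadR-*R (leadR-dot lv lw) (leadR-invR (leadR-dot lw lw) w′≢0))
  where
  index : ∀ e d → e ℤ.+ d ℤ.+ ℤ.- (d ℤ.+ d) ≡ e ℤ.- d
  index = solve-∀

leadV-eliminate : ∀ {m ρ z μ d e} {acc w : Vec RatFun m} {acc′ w′} → LeadR ρ z μ → z ℤ.+ d ≡ e
                → LeadV acc e acc′ → LeadV w d w′
                → LeadV (Vec.zipWith (λ a b → a +R (-R (ρ *R b))) acc w) e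
                        (Vec.zipWith (λ a b → a ℚ.+ (ℚ.- (μ ℚ.* b))) acc′ w′)
leadV-eliminate lρ z+d≡e []          []          = []
leadV-eliminate lρ z+d≡e (la ∷ lacc) (lb ∷ lw) =
  leadR-+R la (leadR-negR (subst (λ z → LeadR _ z _) z+d≡e (leadR-*R lρ lb))) ∷ leadV-eliminate lρ z+d≡e lacc lw

LeadNondeg : ∀ {m} → Vec RatFun m → Vec ℚ m → Set
LeadNondeg w w′ = Σ[ d ∈ ℤ ] LeadV w d w′ × GSℚ.dot w′ w′ ≢ 0ℚ

leadV-step : ∀ {m} {v : Vec RatFun m} {e v′ ws ws′} → LeadV v e v′ → ListPW.Pointwise LeadNondeg ws ws′
           → LeadV (GSR.step ws v) e (GSℚ.step ws′ v′)
leadV-step {v = v} {e} {v′} lv = fold lv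
  where
  fold : ∀ {acc acc′ ws ws′} → LeadV acc e acc′ → ListPW.Pointwise LeadNondeg ws ws′
       → LeadV (List.foldl (λ acc w → Vec.zipWith (λ a b → a +R (-R (GSR.coeff v w *R b))) acc w) acc ws) e
               (List.foldl (λ acc w → Vec.zipWith (λ a b → a ℚ.+ (ℚ.- (GSℚ.coeff v′ w ℚ.* b))) acc w) acc′ ws′)
  fold lacc ListPW.[]                     = lacc
  fold lacc ((d , lw , w′≢0) ListPW.∷ pw) =
    fold (leadV-eliminate (leadR-coeff lv lw w′≢0) (i-j+j≡i e d) lacc lw) pw

leadV-go : ∀ {m k} {ws ws′} (vs : Vec (Vec RatFun m) k) (vs′ : Vec (Vec ℚ m) k) (d : Fin k → ℤ)
         → ListPW.Pointwise LeadNondeg ws ws′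
         → (∀ i → LeadV (lookup vs i) (d i) (lookup vs′ i))
         → (∀ i → GSℚ.dot (lookup (GSℚ.go ws′ vs′) i) (lookup (GSℚ.go ws′ vs′) i) ≢ 0ℚ)
         → ∀ i → LeadV (lookup (GSR.go ws vs) i) (d i) (lookup (GSℚ.go ws′ vs′) i)
leadV-go []       []         d pw lvs nondeg ()
leadV-go (v ∷ vs) (v′ ∷ vs′) d pw lvs nondeg = λ
  { zero    → step
  ; (suc i) → leadV-go vs vs′ (λ i → d (suc i)) (ListPW.++⁺ pw ((d zero , step , nondeg zero) ListPW.∷ ListPW.[]))
                        (λ i → lvs (suc i)) (λ i → nondeg (suc i)) i
  }
  where step = leadV-step (lvs zero) pw

-- Gram–Schmidt over ℚ does not degenerate on independent vectors

module _ {m : ℕ} where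

  0ᵥ : Vec ℚ m
  0ᵥ = replicate m 0ℚ

  infixl 6 _+ᵥ_
  infixl 7 _·ᵥ_

  _+ᵥ_ : Vec ℚ m → Vec ℚ m → Vec ℚ m
  _+ᵥ_ = Vec.zipWith ℚ._+_

  _·ᵥ_ : ℚ → Vec ℚ m → Vec ℚ m
  c ·ᵥ x = Vec.map (c ℚ.*_) x

+ᵥ-identityˡ : ∀ {m} (x : Vec ℚ m) → 0ᵥ +ᵥ x ≡ x
+ᵥ-identityˡ = VecP.zipWith-identityˡ ℚP.+-identityˡ

+ᵥ-identityʳ : ∀ {m} (x : Vec ℚ m) → x +ᵥ 0ᵥ ≡ x
+ᵥ-identityʳ = VecP.zipWith-identityʳ ℚP.+-identityʳ

+ᵥ-assoc : ∀ {m} (x y z : Vec ℚ m) → x +ᵥ y +ᵥ z ≡ x +ᵥ (y +ᵥ z)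
+ᵥ-assoc = VecP.zipWith-assoc ℚP.+-assoc

+ᵥ-comm : ∀ {m} (x y : Vec ℚ m) → x +ᵥ y ≡ y +ᵥ x
+ᵥ-comm = VecP.zipWith-comm ℚP.+-comm

+ᵥ-interchange : ∀ {m} (w x y z : Vec ℚ m) → (w +ᵥ x) +ᵥ (y +ᵥ z) ≡ (w +ᵥ y) +ᵥ (x +ᵥ z)
+ᵥ-interchange []       []       []       []       = refl
+ᵥ-interchange (a ∷ w) (b ∷ x) (c ∷ y) (d ∷ z) =
  cong₂ _∷_ (solve 4 (λ a b c d → (a :+ b) :+ (c :+ d) := (a :+ c) :+ (b :+ d)) refl a b c d) (+ᵥ-interchange w x y z)

·ᵥ-zeroˡ : ∀ {m} (x : Vec ℚ m) → 0ℚ ·ᵥ x ≡ 0ᵥ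
·ᵥ-zeroˡ []      = refl
·ᵥ-zeroˡ (a ∷ x) = cong₂ _∷_ (ℚP.*-zeroˡ a) (·ᵥ-zeroˡ x)

·ᵥ-zeroʳ : ∀ {m} c → c ·ᵥ 0ᵥ {m} ≡ 0ᵥ
·ᵥ-zeroʳ {m} c = trans (VecP.map-replicate (c ℚ.*_) 0ℚ m) (cong (replicate m) (ℚP.*-zeroʳ c))

·ᵥ-identityˡ : ∀ {m} (x : Vec ℚ m) → 1ℚ ·ᵥ x ≡ x
·ᵥ-identityˡ x = trans (VecP.map-cong ℚP.*-identityˡ x) (VecP.map-id x)

·ᵥ-distribˡ : ∀ {m} c (x y : Vec ℚ m) → c ·ᵥ (x +ᵥ y) ≡ c ·ᵥ x +ᵥ c ·ᵥ y
·ᵥ-distribˡ c []      []      = refl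
·ᵥ-distribˡ c (a ∷ x) (b ∷ y) = cong₂ _∷_ (ℚP.*-distribˡ-+ c a b) (·ᵥ-distribˡ c x y)

·ᵥ-distribʳ : ∀ {m} a b (x : Vec ℚ m) → (a ℚ.+ b) ·ᵥ x ≡ a ·ᵥ x +ᵥ b ·ᵥ x
·ᵥ-distribʳ a b []      = refl
·ᵥ-distribʳ a b (c ∷ x) = cong₂ _∷_ (ℚP.*-distribʳ-+ c a b) (·ᵥ-distribʳ a b x)

·ᵥ-assoc : ∀ {m} c d (x : Vec ℚ m) → (c ℚ.* d) ·ᵥ x ≡ c ·ᵥ (d ·ᵥ x)
·ᵥ-assoc c d []      = refl
·ᵥ-assoc c d (a ∷ x) = cong₂ _∷_ (ℚP.*-assoc c d a) (·ᵥ-assoc c d x)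

Coeffs : ∀ {m} → List (Vec ℚ m) → Set
Coeffs = All (λ _ → ℚ)

zeros : ∀ {m} (L : List (Vec ℚ m)) → Coeffs L
zeros = All.universal (λ _ → 0ℚ)

linCombL : ∀ {m} {L : List (Vec ℚ m)} → Coeffs L → Vec ℚ m
linCombL []                = 0ᵥ
linCombL {L = w ∷ _} (c ∷ cs) = c ·ᵥ w +ᵥ linCombL cs

linCombL-zeros : ∀ {m} (L : List (Vec ℚ m)) → linCombL (zeros L) ≡ 0ᵥ
linCombL-zeros []      = refl
linCombL-zeros (w ∷ L) = trans (cong₂ _+ᵥ_ (·ᵥ-zeroˡ w) (linCombL-zeros L)) (+ᵥ-identityˡ 0ᵥ)

linCombL-++⁺ : ∀ {m} {L M : List (Vec ℚ m)} (cs : Coeffs L) (ds : Coeffs M)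
             → linCombL (AllP.++⁺ cs ds) ≡ linCombL cs +ᵥ linCombL ds
linCombL-++⁺ []               ds = sym (+ᵥ-identityˡ _)
linCombL-++⁺ {L = w ∷ _} (c ∷ cs) ds =
  trans (cong (c ·ᵥ w +ᵥ_) (linCombL-++⁺ cs ds)) (sym (+ᵥ-assoc _ _ _))

linCombL-+ : ∀ {m} {L : List (Vec ℚ m)} (cs ds : Coeffs L)
           → linCombL (All.zipWith (λ (c , d) → c ℚ.+ d) (cs , ds)) ≡ linCombL cs +ᵥ linCombL ds
linCombL-+ []               []       = sym (+ᵥ-identityˡ 0ᵥ)
linCombL-+ {L = w ∷ _} (c ∷ cs) (d ∷ ds) =
  trans (cong₂ _+ᵥ_ (·ᵥ-distribʳ c d w) (linCombL-+ cs ds)) (+ᵥ-interchange _ _ _ _)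

linCombL-· : ∀ {m} {L : List (Vec ℚ m)} c (cs : Coeffs L) → linCombL (All.map (c ℚ.*_) cs) ≡ c ·ᵥ linCombL cs
linCombL-· c []               = sym (·ᵥ-zeroʳ c)
linCombL-· {L = w ∷ _} c (d ∷ ds) =
  trans (cong₂ _+ᵥ_ (·ᵥ-assoc c d w) (linCombL-· c ds)) (sym (·ᵥ-distribˡ c _ _))

_∈Span_ : ∀ {m} → Vec ℚ m → List (Vec ℚ m) → Set
x ∈Span L = Σ[ cs ∈ Coeffs L ] linCombL cs ≡ x

∈Span-++ʳ : ∀ {m} {x : Vec ℚ m} {L} M → x ∈Span L → x ∈Span (L ++ M)
∈Span-++ʳ M (cs , refl) = AllP.++⁺ cs (zeros M) ,
  trans (linCombL-++⁺ cs (zeros M)) (trans (cong (_ +ᵥ_) (linCombL-zeros M)) (+ᵥ-identityʳ _))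

eliminate-ℚ : ∀ {m} c (x y : Vec ℚ m) → Vec.zipWith (λ a b → a ℚ.+ (ℚ.- (c ℚ.* b))) x y ≡ x +ᵥ (ℚ.- c) ·ᵥ y
eliminate-ℚ c []      []      = refl
eliminate-ℚ c (a ∷ x) (b ∷ y) = cong₂ _∷_ (cong (a ℚ.+_) (ℚP.neg-distribˡ-* c b)) (eliminate-ℚ c x y)

step-∈v+Span : ∀ {m} (v : Vec ℚ m) {pre} ws → All (_∈Span pre) ws
             → Σ[ cs ∈ Coeffs pre ] GSℚ.step ws v ≡ v +ᵥ linCombL cs
step-∈v+Span v {pre} ws ws∈ =
  fold ws ws∈ (zeros pre) (sym (trans (cong (v +ᵥ_) (linCombL-zeros pre)) (+ᵥ-identityʳ v)))
  where
  fold : ∀ {acc} ws → All (_∈Span pre) ws → (cs : Coeffs pre) → acc ≡ v +ᵥ linCombL cs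
       → Σ[ cs ∈ Coeffs pre ] List.foldl (λ acc w → Vec.zipWith (λ a b → a ℚ.+ (ℚ.- (GSℚ.coeff v w ℚ.* b))) acc w) acc ws
                             ≡ v +ᵥ linCombL cs
  fold []       []                cs acc≡ = cs , acc≡
  fold {acc} (w ∷ ws) ((ds , refl) ∷ ws∈) cs acc≡ =
    fold ws ws∈ (All.zipWith (λ (c , d) → c ℚ.+ d) (cs , All.map (μ ℚ.*_) ds)) (begin
      Vec.zipWith (λ a b → a ℚ.+ (ℚ.- (GSℚ.coeff v w ℚ.* b))) acc w ≡⟨ eliminate-ℚ (GSℚ.coeff v w) acc w ⟩
      acc +ᵥ μ ·ᵥ w                                                  ≡⟨ cong (_+ᵥ μ ·ᵥ w) acc≡ ⟩
      v +ᵥ linCombL cs +ᵥ μ ·ᵥ w                                     ≡⟨ +ᵥ-assoc v _ _ ⟩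
      v +ᵥ (linCombL cs +ᵥ μ ·ᵥ w)                                   ≡⟨ cong (λ y → v +ᵥ (_ +ᵥ y)) (linCombL-· μ ds) ⟨
      v +ᵥ (linCombL cs +ᵥ linCombL (All.map (μ ℚ.*_) ds))           ≡⟨ cong (v +ᵥ_) (linCombL-+ cs _) ⟨
      v +ᵥ linCombL (All.zipWith (λ (c , d) → c ℚ.+ d) (cs , All.map (μ ℚ.*_) ds)) ∎)
    where
    open ≡-Reasoning
    μ = ℚ.- GSℚ.coeff v w

LinIndepL : ∀ {m} → List (Vec ℚ m) → Set
LinIndepL L = ∀ (cs : Coeffs L) → linCombL cs ≡ 0ᵥ → cs ≡ zeros L

module _ {m : ℕ} where

  coeffsToVec : ∀ {n} (P : Vec (Vec ℚ m) n) → Coeffs (Vec.toList P) → Vec ℚ n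
  coeffsToVec []      []       = []
  coeffsToVec (_ ∷ P) (c ∷ cs) = c ∷ coeffsToVec P cs

  linComb-coeffsToVec : ∀ {n} (P : Vec (Vec ℚ m) n) cs → linComb (coeffsToVec P cs) P ≡ linCombL cs
  linComb-coeffsToVec []      []       = refl
  linComb-coeffsToVec (w ∷ P) (c ∷ cs) = cong (c ·ᵥ w +ᵥ_) (linComb-coeffsToVec P cs)

  coeffsToVec-zero : ∀ {n} (P : Vec (Vec ℚ m) n) cs → coeffsToVec P cs ≡ replicate n 0ℚ → cs ≡ zeros (Vec.toList P)
  coeffsToVec-zero []      []       _   = refl
  coeffsToVec-zero (w ∷ P) (c ∷ cs) eq =
    cong₂ _∷_ (VecP.∷-injectiveˡ eq) (coeffsToVec-zero P cs (VecP.∷-injectiveʳ eq))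

  linIndep-toList : ∀ {n} (P : Vec (Vec ℚ m) n) → LinIndepℚ P → LinIndepL (Vec.toList P)
  linIndep-toList P li cs lc≡0 =
    coeffsToVec-zero P cs (li (coeffsToVec P cs) (trans (linComb-coeffsToVec P cs) lc≡0))

  ++⁺-≡zeros : ∀ {L w} {M : List (Vec ℚ m)} (cs : Coeffs L) {c} {ds : Coeffs M}
             → AllP.++⁺ cs (c ∷ ds) ≡ zeros (L ++ w ∷ M) → c ≡ 0ℚ
  ++⁺-≡zeros []       eq = cong All.head eq
  ++⁺-≡zeros (_ ∷ cs) eq = ++⁺-≡zeros cs (cong All.tail eq)

-- Despite its name, ℚP.nonPos*nonPos⇒nonPos concludes NonNegative.
0≤p*p : ∀ p → 0ℚ ≤ p ℚ.* p
0≤p*p p with ℚP.≤-total 0ℚ p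
... | inj₁ 0≤p = ℚP.nonNegative⁻¹ _ {{ℚP.nonNeg*nonNeg⇒nonNeg p {{ℚ.nonNegative 0≤p}} p {{ℚ.nonNegative 0≤p}}}}
... | inj₂ p≤0 = ℚP.nonNegative⁻¹ _ {{ℚP.nonPos*nonPos⇒nonPos p {{ℚ.nonPositive p≤0}} p {{ℚ.nonPositive p≤0}}}}

dot-self-nonNeg : ∀ {m} (w : Vec ℚ m) → 0ℚ ≤ GSℚ.dot w w
dot-self-nonNeg []      = ℚP.≤-refl
dot-self-nonNeg (a ∷ w) = ℚP.+-mono-≤ (0≤p*p a) (dot-self-nonNeg w)

0≤p∧0≤q∧p+q≡0⇒p≡0 : ∀ {p q} → 0ℚ ≤ p → 0ℚ ≤ q → p ℚ.+ q ≡ 0ℚ → p ≡ 0ℚ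
0≤p∧0≤q∧p+q≡0⇒p≡0 {p} 0≤p 0≤q p+q≡0 = ℚP.≤-antisym (subst₂ _≤_ (ℚP.+-identityʳ p) p+q≡0 (ℚP.+-monoʳ-≤ p 0≤q)) 0≤p

dot-self≡0 : ∀ {m} (w : Vec ℚ m) → GSℚ.dot w w ≡ 0ℚ → w ≡ 0ᵥ
dot-self≡0 []      _     = refl
dot-self≡0 (a ∷ w) ww≡0 = cong₂ _∷_ a≡0 (dot-self≡0 w rest≡0)
  where
  aa≡0 = 0≤p∧0≤q∧p+q≡0⇒p≡0 (0≤p*p a) (dot-self-nonNeg w) ww≡0
  rest≡0 = 0≤p∧0≤q∧p+q≡0⇒p≡0 (dot-self-nonNeg w) (0≤p*p a) (trans (ℚP.+-comm (GSℚ.dot w w) (a ℚ.* a)) ww≡0)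
  a≡0 : a ≡ 0ℚ
  a≡0 with a ≟ 0ℚ
  ... | yes a≡0 = a≡0
  ... | no a≢0  = ⊥-elim (p≢0∧q≢0⇒p*q≢0 a≢0 a≢0 aa≡0)

dot-0ᵥ : ∀ {m} → GSℚ.dot (0ᵥ {m}) 0ᵥ ≡ 0ℚ
dot-0ᵥ {zero}  = refl
dot-0ᵥ {suc m} = cong (0ℚ ℚ.* 0ℚ ℚ.+_) (dot-0ᵥ {m})

-- The Gram–Schmidt vector of v is v plus a combination of the earlier input vectors pre,
-- so independence forbids it being 0.
go-nondegenerate : ∀ {m k} (pre : List (Vec ℚ m)) ws (vs : Vec (Vec ℚ m) k)
                 → LinIndepL (pre ++ Vec.toList vs) → All (_∈Span pre) ws
                 → ∀ i → GSℚ.dot (lookup (GSℚ.go ws vs) i) (lookup (GSℚ.go ws vs) i) ≢ 0ℚ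
go-nondegenerate pre ws []       li ws∈ ()
go-nondegenerate pre ws (v ∷ vs) li ws∈ = λ
  { zero    → s-nondegenerate
  ; (suc i) → go-nondegenerate (pre ++ [ v ]) (ws ++ [ s ]) vs li′ ws∈′ i
  }
  where
  s = GSℚ.step ws v
  s-affine = step-∈v+Span v ws ws∈
  as = proj₁ s-affine
  s≡ : ∀ M → linCombL (AllP.++⁺ as (1ℚ ∷ zeros M)) ≡ s
  s≡ M = begin
    linCombL (AllP.++⁺ as (1ℚ ∷ zeros M))
      ≡⟨ linCombL-++⁺ as (1ℚ ∷ zeros M) ⟩
    linCombL as +ᵥ (1ℚ ·ᵥ v +ᵥ linCombL (zeros M))
      ≡⟨ cong₂ (λ x y → linCombL as +ᵥ (x +ᵥ y)) (·ᵥ-identityˡ v) (linCombL-zeros M) ⟩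
    linCombL as +ᵥ (v +ᵥ 0ᵥ)   ≡⟨ cong (linCombL as +ᵥ_) (+ᵥ-identityʳ v) ⟩
    linCombL as +ᵥ v           ≡⟨ +ᵥ-comm _ v ⟩
    v +ᵥ linCombL as           ≡⟨ proj₂ s-affine ⟨
    s                          ∎
    where open ≡-Reasoning
  s-nondegenerate : GSℚ.dot s s ≢ 0ℚ
  s-nondegenerate ss≡0 = ℚP.1≢0 (++⁺-≡zeros as (li (AllP.++⁺ as (1ℚ ∷ zeros (Vec.toList vs)))
                                                     (trans (s≡ (Vec.toList vs)) (dot-self≡0 s ss≡0))))
  li′ = subst LinIndepL (sym (ListP.++-assoc pre [ v ] (Vec.toList vs))) li
  ws∈′ = AllP.++⁺ (All.map (∈Span-++ʳ [ v ]) ws∈) ((AllP.++⁺ as (1ℚ ∷ []) , s≡ []) ∷ [])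

gsVecs-nondegenerate : ∀ {m n} (P : Vec (Vec ℚ m) n) → LinIndepℚ P
                     → ∀ i → GSℚ.dot (lookup (GSℚ.gsVecs P) i) (lookup (GSℚ.gsVecs P) i) ≢ 0ℚ
gsVecs-nondegenerate P li = go-nondegenerate [] [] P (linIndep-toList P li) []

module _ {r : ℚ} where

  *-monoˡ-≤-0≤ : ∀ {p q} → 0ℚ ≤ r → p ≤ q → r ℚ.* p ≤ r ℚ.* q
  *-monoˡ-≤-0≤ 0≤r = ℚP.*-monoˡ-≤-nonNeg r {{ℚ.nonNegative 0≤r}}

  *-monoʳ-≤-0≤ : ∀ {p q} → 0ℚ ≤ r → p ≤ q → p ℚ.* r ≤ q ℚ.* r
  *-monoʳ-≤-0≤ 0≤r = ℚP.*-monoʳ-≤-nonNeg r {{ℚ.nonNegative 0≤r}}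

  *-monoʳ-<-0< : ∀ {p q} → 0ℚ < r → p < q → p ℚ.* r < q ℚ.* r
  *-monoʳ-<-0< 0<r = ℚP.*-monoˡ-<-pos r {{ℚ.positive 0<r}}

  *-cancelʳ-<-0≤ : ∀ {p q} → 0ℚ ≤ r → p ℚ.* r < q ℚ.* r → p < q
  *-cancelʳ-<-0≤ 0≤r = ℚP.*-cancelʳ-<-nonNeg r {{ℚ.nonNegative 0≤r}}

0≤p∧0≤q⇒0≤p*q : ∀ {p q} → 0ℚ ≤ p → 0ℚ ≤ q → 0ℚ ≤ p ℚ.* q
0≤p∧0≤q⇒0≤p*q {p} {q} 0≤p 0≤q =
  ℚP.nonNegative⁻¹ _ {{ℚP.nonNeg*nonNeg⇒nonNeg p {{ℚ.nonNegative 0≤p}} q {{ℚ.nonNegative 0≤q}}}}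

p<p+1 : ∀ p → p < p ℚ.+ 1ℚ
p<p+1 p = subst (_< p ℚ.+ 1ℚ) (ℚP.+-identityʳ p) (ℚP.+-monoʳ-< p (ℚP.positive⁻¹ 1ℚ))

0≤1 : 0ℚ ≤ 1ℚ
0≤1 = ℚP.<⇒≤ (ℚP.positive⁻¹ 1ℚ)

1≤t⇒0<t : ∀ {t} → 1ℚ ≤ t → 0ℚ < t
1≤t⇒0<t = ℚP.<-≤-trans (ℚP.positive⁻¹ 1ℚ)

1≤t⇒1≤t^n : ∀ {t} n → 1ℚ ≤ t → 1ℚ ≤ t ^ℚ n
1≤t⇒1≤t^n zero    1≤t = ℚP.≤-refl
1≤t⇒1≤t^n {t} (suc n) 1≤t = begin
  1ℚ                ≤⟨ 1≤t⇒1≤t^n n 1≤t ⟩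
  t ^ℚ n            ≡⟨ ℚP.*-identityˡ (t ^ℚ n) ⟨
  1ℚ ℚ.* t ^ℚ n     ≤⟨ *-monoʳ-≤-0≤ (ℚP.≤-trans 0≤1 (1≤t⇒1≤t^n n 1≤t)) 1≤t ⟩
  t ℚ.* t ^ℚ n      ∎
  where open ℚP.≤-Reasoning

‖_‖ : Poly → ℚ
‖ []    ‖ = 0ℚ
‖ a ∷ p ‖ = ℚ.∣ a ∣ ℚ.+ ‖ p ‖

‖‖-nonNeg : ∀ p → 0ℚ ≤ ‖ p ‖
‖‖-nonNeg []      = ℚP.≤-refl
‖‖-nonNeg (a ∷ p) = ℚP.+-mono-≤ (ℚP.0≤∣p∣ a) (‖‖-nonNeg p)

evalP-isZero : ∀ p t → IsZeroP p → evalP p t ≡ 0ℚ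
evalP-isZero []      t _   = refl
evalP-isZero (a ∷ p) t p≡0 = begin
  a ℚ.+ t ℚ.* evalP p t  ≡⟨ cong₂ (λ a e → a ℚ.+ t ℚ.* e) (p≡0 zero) (evalP-isZero p t (λ j → p≡0 (suc j))) ⟩
  0ℚ ℚ.+ t ℚ.* 0ℚ        ≡⟨ solve 1 (λ t → con 0ℚ :+ t :* con 0ℚ := con 0ℚ) refl t ⟩
  0ℚ                     ∎
  where open ≡-Reasoning

-- Multiplied by t so that no division by t is needed.
evalP-top-bound : ∀ p n {t} → 1ℚ ≤ t → VanishesFrom p (suc n)
                → ℚ.∣ evalP p t ℚ.- coeffP p n ℚ.* t ^ℚ n ∣ ℚ.* t ≤ ‖ p ‖ ℚ.* t ^ℚ n
evalP-top-bound [] n {t} _ _ = ℚP.≤-reflexive (begin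
  ℚ.∣ 0ℚ ℚ.- 0ℚ ℚ.* T ∣ ℚ.* t
    ≡⟨ cong (λ x → ℚ.∣ x ∣ ℚ.* t) (solve 1 (λ T → con 0ℚ :- con 0ℚ :* T := con 0ℚ) refl T) ⟩
  0ℚ ℚ.* t   ≡⟨ ℚP.*-zeroˡ t ⟩
  0ℚ         ≡⟨ ℚP.*-zeroˡ T ⟨
  0ℚ ℚ.* T   ∎)
  where
  open ≡-Reasoning
  T = t ^ℚ n
evalP-top-bound (a ∷ p) zero {t} _ vanishes = begin
  ℚ.∣ a ℚ.+ t ℚ.* evalP p t ℚ.- a ℚ.* 1ℚ ∣ ℚ.* t
    ≡⟨ cong (λ e → ℚ.∣ a ℚ.+ t ℚ.* e ℚ.- a ℚ.* 1ℚ ∣ ℚ.* t) (evalP-isZero p t (λ j → vanishes (suc j) (s≤s z≤n))) ⟩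
  ℚ.∣ a ℚ.+ t ℚ.* 0ℚ ℚ.- a ℚ.* 1ℚ ∣ ℚ.* t
    ≡⟨ cong (λ x → ℚ.∣ x ∣ ℚ.* t) (solve 2 (λ a t → a :+ t :* con 0ℚ :- a :* con 1ℚ := con 0ℚ) refl a t) ⟩
  0ℚ ℚ.* t           ≡⟨ ℚP.*-zeroˡ t ⟩
  0ℚ                 ≤⟨ 0≤p∧0≤q⇒0≤p*q (‖‖-nonNeg (a ∷ p)) 0≤1 ⟩
  ‖ a ∷ p ‖ ℚ.* 1ℚ   ∎
  where open ℚP.≤-Reasoning
evalP-top-bound (a ∷ p) (suc n) {t} 1≤t vanishes = begin
  ℚ.∣ a ℚ.+ t ℚ.* evalP p t ℚ.- c ℚ.* (t ℚ.* T) ∣ ℚ.* t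
    ≡⟨ cong (λ x → ℚ.∣ x ∣ ℚ.* t) (solve 5 (λ a t e c T → a :+ t :* e :- c :* (t :* T) := a :+ t :* (e :- c :* T))
                                           refl a t (evalP p t) c T) ⟩
  ℚ.∣ a ℚ.+ t ℚ.* E ∣ ℚ.* t
    ≤⟨ *-monoʳ-≤-0≤ 0≤t (ℚP.∣p+q∣≤∣p∣+∣q∣ a (t ℚ.* E)) ⟩
  (ℚ.∣ a ∣ ℚ.+ ℚ.∣ t ℚ.* E ∣) ℚ.* t
    ≡⟨ cong (λ x → (ℚ.∣ a ∣ ℚ.+ x) ℚ.* t) ∣tE∣≡t∣E∣ ⟩
  (ℚ.∣ a ∣ ℚ.+ t ℚ.* ℚ.∣ E ∣) ℚ.* t
    ≡⟨ solve 3 (λ x t y → (x :+ t :* y) :* t := x :* t :+ t :* (y :* t)) refl ℚ.∣ a ∣ t ℚ.∣ E ∣ ⟩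
  ℚ.∣ a ∣ ℚ.* t ℚ.+ t ℚ.* (ℚ.∣ E ∣ ℚ.* t)
    ≤⟨ ℚP.+-mono-≤ ∣a∣t≤∣a∣tT (*-monoˡ-≤-0≤ 0≤t (evalP-top-bound p n 1≤t (λ j n<j → vanishes (suc j) (s≤s n<j)))) ⟩
  ℚ.∣ a ∣ ℚ.* t ℚ.* T ℚ.+ t ℚ.* (‖ p ‖ ℚ.* T)
    ≡⟨ solve 4 (λ x t N T → x :* t :* T :+ t :* (N :* T) := (x :+ N) :* (t :* T)) refl ℚ.∣ a ∣ t ‖ p ‖ T ⟩
  (ℚ.∣ a ∣ ℚ.+ ‖ p ‖) ℚ.* (t ℚ.* T)
    ∎
  where
  open ℚP.≤-Reasoning
  T = t ^ℚ n
  c = coeffP p n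
  E = evalP p t ℚ.- c ℚ.* T
  0≤t = ℚP.<⇒≤ (1≤t⇒0<t 1≤t)
  ∣tE∣≡t∣E∣ : ℚ.∣ t ℚ.* E ∣ ≡ t ℚ.* ℚ.∣ E ∣
  ∣tE∣≡t∣E∣ = trans (ℚP.∣p*q∣≡∣p∣*∣q∣ t E) (cong (ℚ._* ℚ.∣ E ∣) (ℚP.0≤p⇒∣p∣≡p 0≤t))
  ∣a∣t≤∣a∣tT : ℚ.∣ a ∣ ℚ.* t ≤ ℚ.∣ a ∣ ℚ.* t ℚ.* T
  ∣a∣t≤∣a∣tT = subst (_≤ ℚ.∣ a ∣ ℚ.* t ℚ.* T) (ℚP.*-identityʳ _)
    (*-monoˡ-≤-0≤ (0≤p∧0≤q⇒0≤p*q (ℚP.0≤∣p∣ a) 0≤t) (1≤t⇒1≤t^n n 1≤t))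

evalP-vanishing-bound : ∀ p n {t} → 1ℚ ≤ t → VanishesFrom p n → ℚ.∣ evalP p t ∣ ℚ.* t ≤ ‖ p ‖ ℚ.* t ^ℚ n
evalP-vanishing-bound p n {t} 1≤t vanishes =
  subst (λ x → ℚ.∣ x ∣ ℚ.* t ≤ ‖ p ‖ ℚ.* t ^ℚ n) e (evalP-top-bound p n 1≤t (λ j n<j → vanishes j (ℕP.<⇒≤ n<j)))
  where
  e : evalP p t ℚ.- coeffP p n ℚ.* t ^ℚ n ≡ evalP p t
  e = begin
    evalP p t ℚ.- coeffP p n ℚ.* t ^ℚ n ≡⟨ cong (λ c → evalP p t ℚ.- c ℚ.* t ^ℚ n) (vanishes n ℕP.≤-refl) ⟩
    evalP p t ℚ.- 0ℚ ℚ.* t ^ℚ n         ≡⟨ solve 2 (λ e T → e :- con 0ℚ :* T := e) refl (evalP p t) (t ^ℚ n) ⟩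
    evalP p t                           ∎
    where open ≡-Reasoning

p≤∣p∣ : ∀ p → p ≤ ℚ.∣ p ∣
p≤∣p∣ p with ℚP.≤-total 0ℚ p
... | inj₁ 0≤p = ℚP.≤-reflexive (sym (ℚP.0≤p⇒∣p∣≡p 0≤p))
... | inj₂ p≤0 = ℚP.≤-trans p≤0 (ℚP.0≤∣p∣ p)

-∣p∣≤p : ∀ p → ℚ.- ℚ.∣ p ∣ ≤ p
-∣p∣≤p p = subst₂ _≤_ (cong ℚ.-_ (ℚP.∣-p∣≡∣p∣ p)) (solve 1 (λ p → :- (:- p) := p) refl p)
                      (ℚP.neg-antimono-≤ (p≤∣p∣ (ℚ.- p)))

0<∣p∣ : ∀ {p} → p ≢ 0ℚ → 0ℚ < ℚ.∣ p ∣
0<∣p∣ {p} p≢0 with ℚP.<-cmp 0ℚ ℚ.∣ p ∣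
... | tri< 0<∣p∣ _ _ = 0<∣p∣
... | tri≈ _ 0≡∣p∣ _ = ⊥-elim (p≢0 (ℚP.∣p∣≡0⇒p≡0 p (sym 0≡∣p∣)))
... | tri> _ _ ∣p∣<0 = ⊥-elim (ℚP.<-irrefl refl (ℚP.<-≤-trans ∣p∣<0 (ℚP.0≤∣p∣ p)))

+-cancelʳ-≤ : ∀ {p q} r → p ℚ.+ r ≤ q ℚ.+ r → p ≤ q
+-cancelʳ-≤ {p} {q} r p+r≤q+r = subst₂ _≤_ (cancel p) (cancel q) (ℚP.+-monoˡ-≤ (ℚ.- r) p+r≤q+r)
  where
  cancel : ∀ x → x ℚ.+ r ℚ.- r ≡ x
  cancel x = solve 2 (λ x r → x :+ r :- r := x) refl x r

∣x-y∣<∣y∣⇒0<x*y : ∀ {x y} → ℚ.∣ x ℚ.- y ∣ < ℚ.∣ y ∣ → 0ℚ < x ℚ.* y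
∣x-y∣<∣y∣⇒0<x*y {x} {y} close = begin-strict
  0ℚ                                          ≡⟨ ℚP.+-inverseʳ (ℚ.∣ d ∣ ℚ.* ℚ.∣ y ∣) ⟨
  ℚ.∣ d ∣ ℚ.* ℚ.∣ y ∣ ℚ.- ℚ.∣ d ∣ ℚ.* ℚ.∣ y ∣  <⟨ ℚP.+-monoˡ-< _ (*-monoʳ-<-0< 0<∣y∣ close) ⟩
  ℚ.∣ y ∣ ℚ.* ℚ.∣ y ∣ ℚ.- ℚ.∣ d ∣ ℚ.* ℚ.∣ y ∣  ≡⟨ cong₂ (λ a b → a ℚ.- b) ∣y∣∣y∣≡yy (sym (ℚP.∣p*q∣≡∣p∣*∣q∣ d y)) ⟩
  y ℚ.* y ℚ.- ℚ.∣ d ℚ.* y ∣                    ≤⟨ ℚP.+-monoʳ-≤ (y ℚ.* y) (-∣p∣≤p (d ℚ.* y)) ⟩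
  y ℚ.* y ℚ.+ d ℚ.* y                          ≡⟨ solve 2 (λ x y → y :* y :+ (x :- y) :* y := x :* y) refl x y ⟩
  x ℚ.* y                                      ∎
  where
  open ℚP.≤-Reasoning
  d = x ℚ.- y
  0<∣y∣ = ℚP.≤-<-trans (ℚP.0≤∣p∣ d) close
  ∣y∣∣y∣≡yy : ℚ.∣ y ∣ ℚ.* ℚ.∣ y ∣ ≡ y ℚ.* y
  ∣y∣∣y∣≡yy = trans (sym (ℚP.∣p*q∣≡∣p∣*∣q∣ y y)) (ℚP.0≤p⇒∣p∣≡p (0≤p*p y))

eventually-map : ∀ {P Q : ℚ → Set} → (∀ {t} → P t → Q t) → Eventually P → Eventually Q
eventually-map f (N , P) = N , λ t N<t → f (P t N<t)

eventually-∧ : ∀ {P Q : ℚ → Set} → Eventually P → Eventually Q → Eventually (λ t → P t × Q t)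
eventually-∧ (N₁ , P) (N₂ , Q) = N₁ ℚ.⊔ N₂ , λ t N<t →
  P t (ℚP.≤-<-trans (ℚP.p≤p⊔q N₁ N₂) N<t) , Q t (ℚP.≤-<-trans (ℚP.p≤q⊔p N₁ N₂) N<t)

eventually-linear : ∀ {b} → 0ℚ < b → ∀ Y → Eventually (λ t → 1ℚ ≤ t × Y ≤ b ℚ.* t)
eventually-linear {b} 0<b Y = N , λ t N<t →
  ℚP.<⇒≤ (ℚP.≤-<-trans (ℚP.p≤q⊔p (Y ℚ.* invℚ b) 1ℚ) N<t) ,
  ℚP.<⇒≤ (subst (ℚ._< b ℚ.* t) b[Y/b]≡Y
                (ℚP.*-monoʳ-<-pos b {{ℚ.positive 0<b}} (ℚP.≤-<-trans (ℚP.p≤p⊔q (Y ℚ.* invℚ b) 1ℚ) N<t)))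
  where
  N = (Y ℚ.* invℚ b) ℚ.⊔ 1ℚ
  b[Y/b]≡Y : b ℚ.* (Y ℚ.* invℚ b) ≡ Y
  b[Y/b]≡Y = trans (ℚP.*-comm b _) (p*q⁻¹*q≡p (λ b≡0 → ℚP.<-irrefl (sym b≡0) 0<b))

module _ (S : Poly) (n : ℕ) (top≢0 : coeffP S n ≢ 0ℚ) (vanishes : VanishesFrom S (suc n)) where

  private
    b = coeffP S n

    ∣b∣*t*T≡∣b*T∣*t : ∀ {t T} → 0ℚ ≤ T → ℚ.∣ b ∣ ℚ.* t ℚ.* T ≡ ℚ.∣ b ℚ.* T ∣ ℚ.* t
    ∣b∣*t*T≡∣b*T∣*t {t} {T} 0≤T = begin
      ℚ.∣ b ∣ ℚ.* t ℚ.* T     ≡⟨ solve 3 (λ a t T → a :* t :* T := a :* T :* t) refl ℚ.∣ b ∣ t T ⟩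
      ℚ.∣ b ∣ ℚ.* T ℚ.* t     ≡⟨ cong (λ x → ℚ.∣ b ∣ ℚ.* x ℚ.* t) (ℚP.0≤p⇒∣p∣≡p 0≤T) ⟨
      ℚ.∣ b ∣ ℚ.* ℚ.∣ T ∣ ℚ.* t ≡⟨ cong (ℚ._* t) (ℚP.∣p*q∣≡∣p∣*∣q∣ b T) ⟨
      ℚ.∣ b ℚ.* T ∣ ℚ.* t     ∎
      where open ≡-Reasoning

  evalP-grows : ∀ X → Eventually (λ t → 1ℚ ≤ t × X ℚ.* t ^ℚ n ≤ ℚ.∣ evalP S t ∣ ℚ.* t)
  evalP-grows X = eventually-map grows (eventually-linear (0<∣p∣ top≢0) (X ℚ.+ ‖ S ‖))
    where
    grows : ∀ {t} → 1ℚ ≤ t × X ℚ.+ ‖ S ‖ ≤ ℚ.∣ b ∣ ℚ.* t → 1ℚ ≤ t × X ℚ.* t ^ℚ n ≤ ℚ.∣ evalP S t ∣ ℚ.* t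
    grows {t} (1≤t , X+‖S‖≤∣b∣t) = 1≤t , +-cancelʳ-≤ (‖ S ‖ ℚ.* T) (begin
      X ℚ.* T ℚ.+ ‖ S ‖ ℚ.* T                      ≡⟨ ℚP.*-distribʳ-+ T X ‖ S ‖ ⟨
      (X ℚ.+ ‖ S ‖) ℚ.* T                          ≤⟨ *-monoʳ-≤-0≤ 0≤T X+‖S‖≤∣b∣t ⟩
      ℚ.∣ b ∣ ℚ.* t ℚ.* T                          ≡⟨ ∣b∣*t*T≡∣b*T∣*t 0≤T ⟩
      ℚ.∣ b ℚ.* T ∣ ℚ.* t                          ≤⟨ *-monoʳ-≤-0≤ 0≤t triangle ⟩
      (ℚ.∣ s ∣ ℚ.+ ℚ.∣ s ℚ.- b ℚ.* T ∣) ℚ.* t      ≡⟨ ℚP.*-distribʳ-+ t ℚ.∣ s ∣ _ ⟩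
      ℚ.∣ s ∣ ℚ.* t ℚ.+ ℚ.∣ s ℚ.- b ℚ.* T ∣ ℚ.* t  ≤⟨ ℚP.+-monoʳ-≤ (ℚ.∣ s ∣ ℚ.* t) (evalP-top-bound S n 1≤t vanishes) ⟩
      ℚ.∣ s ∣ ℚ.* t ℚ.+ ‖ S ‖ ℚ.* T                ∎)
      where
      open ℚP.≤-Reasoning
      T = t ^ℚ n
      s = evalP S t
      0≤t = ℚP.<⇒≤ (1≤t⇒0<t 1≤t)
      0≤T = ℚP.<⇒≤ (1≤t⇒0<t (1≤t⇒1≤t^n n 1≤t))
      triangle : ℚ.∣ b ℚ.* T ∣ ≤ ℚ.∣ s ∣ ℚ.+ ℚ.∣ s ℚ.- b ℚ.* T ∣
      triangle = subst (λ x → ℚ.∣ x ∣ ≤ ℚ.∣ s ∣ ℚ.+ ℚ.∣ s ℚ.- b ℚ.* T ∣)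
                       (solve 2 (λ s y → s :- (s :- y) := y) refl s (b ℚ.* T))
                       (ℚP.∣p-q∣≤∣p∣+∣q∣ s (s ℚ.- b ℚ.* T))

  evalP-sign : Eventually (λ t → 0ℚ < b ℚ.* evalP S t)
  evalP-sign = eventually-map sign (eventually-linear (0<∣p∣ top≢0) (‖ S ‖ ℚ.+ 1ℚ))
    where
    sign : ∀ {t} → 1ℚ ≤ t × ‖ S ‖ ℚ.+ 1ℚ ≤ ℚ.∣ b ∣ ℚ.* t → 0ℚ < b ℚ.* evalP S t
    sign {t} (1≤t , ‖S‖+1≤∣b∣t) =
      *-cancelʳ-<-0≤ (ℚP.<⇒≤ 0<T) (subst₂ _<_ (sym (ℚP.*-zeroˡ T)) rearrange (∣x-y∣<∣y∣⇒0<x*y {s} {b ℚ.* T} close))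
      where
      T = t ^ℚ n
      s = evalP S t
      0<t = 1≤t⇒0<t 1≤t
      0<T = 1≤t⇒0<t (1≤t⇒1≤t^n n 1≤t)
      ‖S‖<∣b∣t : ‖ S ‖ < ℚ.∣ b ∣ ℚ.* t
      ‖S‖<∣b∣t = ℚP.<-≤-trans (p<p+1 ‖ S ‖) ‖S‖+1≤∣b∣t
      close : ℚ.∣ s ℚ.- b ℚ.* T ∣ < ℚ.∣ b ℚ.* T ∣
      close = *-cancelʳ-<-0≤ (ℚP.<⇒≤ 0<t) (begin-strict
        ℚ.∣ s ℚ.- b ℚ.* T ∣ ℚ.* t  ≤⟨ evalP-top-bound S n 1≤t vanishes ⟩
        ‖ S ‖ ℚ.* T                <⟨ *-monoʳ-<-0< 0<T ‖S‖<∣b∣t ⟩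
        ℚ.∣ b ∣ ℚ.* t ℚ.* T        ≡⟨ ∣b∣*t*T≡∣b*T∣*t (ℚP.<⇒≤ 0<T) ⟩
        ℚ.∣ b ℚ.* T ∣ ℚ.* t        ∎)
        where open ℚP.≤-Reasoning
      rearrange : s ℚ.* (b ℚ.* T) ≡ b ℚ.* s ℚ.* T
      rearrange = solve 3 (λ s b T → s :* (b :* T) := b :* s :* T) refl s b T

StrictSign : (ℚ → ℚ) → Set
StrictSign f = Eventually (λ t → 0ℚ < f t) ⊎ Eventually (λ t → f t < 0ℚ)

WeakSign : (ℚ → ℚ) → Set
WeakSign f = Eventually (λ t → 0ℚ ≤ f t) ⊎ Eventually (λ t → f t ≤ 0ℚ)

strictSign⇒weakSign : ∀ {f} → StrictSign f → WeakSign f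
strictSign⇒weakSign (inj₁ pos) = inj₁ (eventually-map ℚP.<⇒≤ pos)
strictSign⇒weakSign (inj₂ neg) = inj₂ (eventually-map ℚP.<⇒≤ neg)

module _ {p q : ℚ} where

  0≤p∧0<q⇒0≤p/q : 0ℚ ≤ p → 0ℚ < q → 0ℚ ≤ p ℚ.* invℚ q
  0≤p∧0<q⇒0≤p/q 0≤p 0<q = 0≤p∧0≤q⇒0≤p*q 0≤p (ℚP.<⇒≤ (invℚ-pos 0<q))

  p≤0∧0<q⇒p/q≤0 : p ≤ 0ℚ → 0ℚ < q → p ℚ.* invℚ q ≤ 0ℚ
  p≤0∧0<q⇒p/q≤0 p≤0 0<q = ℚP.nonPositive⁻¹ _
    {{ℚP.nonPos*nonNeg⇒nonPos p {{ℚ.nonPositive p≤0}} (invℚ q) {{ℚ.nonNegative (ℚP.<⇒≤ (invℚ-pos 0<q))}}}}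

  0≤p∧q<0⇒p/q≤0 : 0ℚ ≤ p → q < 0ℚ → p ℚ.* invℚ q ≤ 0ℚ
  0≤p∧q<0⇒p/q≤0 0≤p q<0 = ℚP.nonPositive⁻¹ _
    {{ℚP.nonNeg*nonPos⇒nonPos p {{ℚ.nonNegative 0≤p}} (invℚ q) {{ℚ.nonPositive (ℚP.<⇒≤ (invℚ-neg q<0))}}}}

  p≤0∧q<0⇒0≤p/q : p ≤ 0ℚ → q < 0ℚ → 0ℚ ≤ p ℚ.* invℚ q
  p≤0∧q<0⇒0≤p/q p≤0 q<0 = ℚP.nonNegative⁻¹ _
    {{ℚP.nonPos*nonPos⇒nonPos p {{ℚ.nonPositive p≤0}} (invℚ q) {{ℚ.nonPositive (ℚP.<⇒≤ (invℚ-neg q<0))}}}}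

  0<p*q∧0<p⇒0<q : 0ℚ < p ℚ.* q → 0ℚ < p → 0ℚ < q
  0<p*q∧0<p⇒0<q 0<pq 0<p =
    ℚP.*-cancelˡ-<-nonNeg p {{ℚ.nonNegative (ℚP.<⇒≤ 0<p)}} (subst (ℚ._< p ℚ.* q) (sym (ℚP.*-zeroʳ p)) 0<pq)

  0<p*q∧p<0⇒q<0 : 0ℚ < p ℚ.* q → p < 0ℚ → q < 0ℚ
  0<p*q∧p<0⇒q<0 0<pq p<0 =
    ℚP.*-cancelˡ-<-nonPos p {{ℚ.nonPositive (ℚP.<⇒≤ p<0)}} (subst (ℚ._< p ℚ.* q) (sym (ℚP.*-zeroʳ p)) 0<pq)

weakSign-quotient : ∀ {f g} → WeakSign f → StrictSign g → WeakSign (λ t → f t ℚ.* invℚ (g t))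
weakSign-quotient (inj₁ f≥0) (inj₁ g>0) = inj₁ (eventually-map (λ (x , y) → 0≤p∧0<q⇒0≤p/q x y) (eventually-∧ f≥0 g>0))
weakSign-quotient (inj₂ f≤0) (inj₁ g>0) = inj₂ (eventually-map (λ (x , y) → p≤0∧0<q⇒p/q≤0 x y) (eventually-∧ f≤0 g>0))
weakSign-quotient (inj₁ f≥0) (inj₂ g<0) = inj₂ (eventually-map (λ (x , y) → 0≤p∧q<0⇒p/q≤0 x y) (eventually-∧ f≥0 g<0))
weakSign-quotient (inj₂ f≤0) (inj₂ g<0) = inj₁ (eventually-map (λ (x , y) → p≤0∧q<0⇒0≤p/q x y) (eventually-∧ f≤0 g<0))

evalP-strictSign : ∀ S n → coeffP S n ≢ 0ℚ → VanishesFrom S (suc n) → StrictSign (evalP S)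
evalP-strictSign S n b≢0 vanishes with ℚP.<-cmp (coeffP S n) 0ℚ
... | tri< b<0 _ _ = inj₂ (eventually-map (λ 0<bs → 0<p*q∧p<0⇒q<0 0<bs b<0) (evalP-sign S n b≢0 vanishes))
... | tri≈ _ b≡0 _ = ⊥-elim (b≢0 b≡0)
... | tri> _ _ 0<b = inj₁ (eventually-map (λ 0<bs → 0<p*q∧0<p⇒0<q 0<bs 0<b) (evalP-sign S n b≢0 vanishes))

evalP-weakSign : ∀ R → WeakSign (evalP R)
evalP-weakSign R with topP R | topP-spec R
... | nothing      | zeroP R≡0 = inj₁ (0ℚ , λ t _ → ℚP.≤-reflexive (sym (evalP-isZero R t R≡0)))
... | just (k , c) | top (c≡ , above) c≢0 =
  strictSign⇒weakSign (evalP-strictSign R k (λ c≡0 → c≢0 (trans (sym c≡) c≡0)) (λ j k<j → above j (+<+ k<j)))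

quotient→0 : ∀ R S n → coeffP S n ≢ 0ℚ → VanishesFrom S (suc n) → VanishesFrom R n
           → LimAtInfty (λ t → evalP R t ℚ.* invℚ (evalP S t)) 0ℚ
quotient→0 R S n b≢0 vS vR ε 0<ε = eventually-map small (evalP-grows S n b≢0 vS X)
  where
  X = (‖ R ‖ ℚ.+ 1ℚ) ℚ.* invℚ ε
  ε≢0 : ε ≢ 0ℚ
  ε≢0 ε≡0 = ℚP.<-irrefl (sym ε≡0) 0<ε
  εX≡‖R‖+1 : ε ℚ.* X ≡ ‖ R ‖ ℚ.+ 1ℚ
  εX≡‖R‖+1 = trans (ℚP.*-comm ε X) (p*q⁻¹*q≡p ε≢0)
  small : ∀ {t} → 1ℚ ≤ t × X ℚ.* t ^ℚ n ≤ ℚ.∣ evalP S t ∣ ℚ.* t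
        → ℚ.∣ evalP R t ℚ.* invℚ (evalP S t) ℚ.- 0ℚ ∣ < ε
  small {t} (1≤t , XT≤∣s∣t) = begin-strict
    ℚ.∣ r ℚ.* invℚ s ℚ.- 0ℚ ∣           ≡⟨ cong ℚ.∣_∣ (ℚP.+-identityʳ (r ℚ.* invℚ s)) ⟩
    ℚ.∣ r ℚ.* invℚ s ∣                  ≡⟨ trans (ℚP.∣p*q∣≡∣p∣*∣q∣ r (invℚ s)) (cong (ℚ.∣ r ∣ ℚ.*_) (∣invℚ∣ s)) ⟩
    ℚ.∣ r ∣ ℚ.* invℚ ℚ.∣ s ∣            <⟨ *-monoʳ-<-0< (invℚ-pos 0<∣s∣) ∣r∣<ε∣s∣ ⟩
    ε ℚ.* ℚ.∣ s ∣ ℚ.* invℚ ℚ.∣ s ∣      ≡⟨ p*q*q⁻¹≡p (λ ∣s∣≡0 → ℚP.<-irrefl (sym ∣s∣≡0) 0<∣s∣) ⟩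
    ε                                   ∎
    where
    open ℚP.≤-Reasoning
    r = evalP R t
    s = evalP S t
    T = t ^ℚ n
    0<T = 1≤t⇒0<t (1≤t⇒1≤t^n n 1≤t)
    ∣r∣<ε∣s∣ : ℚ.∣ r ∣ < ε ℚ.* ℚ.∣ s ∣
    ∣r∣<ε∣s∣ = *-cancelʳ-<-0≤ (ℚP.<⇒≤ (1≤t⇒0<t 1≤t)) (begin-strict
      ℚ.∣ r ∣ ℚ.* t              ≤⟨ evalP-vanishing-bound R n 1≤t vR ⟩
      ‖ R ‖ ℚ.* T                <⟨ *-monoʳ-<-0< 0<T (p<p+1 ‖ R ‖) ⟩
      (‖ R ‖ ℚ.+ 1ℚ) ℚ.* T       ≡⟨ cong (ℚ._* T) εX≡‖R‖+1 ⟨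
      ε ℚ.* X ℚ.* T              ≡⟨ ℚP.*-assoc ε X T ⟩
      ε ℚ.* (X ℚ.* T)            ≤⟨ *-monoˡ-≤-0≤ (ℚP.<⇒≤ 0<ε) XT≤∣s∣t ⟩
      ε ℚ.* (ℚ.∣ s ∣ ℚ.* t)      ≡⟨ ℚP.*-assoc ε ℚ.∣ s ∣ t ⟨
      ε ℚ.* ℚ.∣ s ∣ ℚ.* t        ∎)
    0<∣s∣ : 0ℚ < ℚ.∣ s ∣
    0<∣s∣ = 0<∣p∣ λ s≡0 → ℚP.<-irrefl (sym (trans (cong (λ x → ε ℚ.* ℚ.∣ x ∣) s≡0) (ℚP.*-zeroʳ ε)))
                              (ℚP.≤-<-trans (ℚP.0≤∣p∣ r) ∣r∣<ε∣s∣)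

evalP-addP : ∀ p q t → evalP (addP p q) t ≡ evalP p t ℚ.+ evalP q t
evalP-addP []      q       t = sym (ℚP.+-identityˡ _)
evalP-addP (a ∷ p) []      t = sym (ℚP.+-identityʳ _)
evalP-addP (a ∷ p) (b ∷ q) t = trans (cong (λ x → a ℚ.+ b ℚ.+ t ℚ.* x) (evalP-addP p q t))
  (solve 5 (λ a b t x y → (a :+ b) :+ t :* (x :+ y) := (a :+ t :* x) :+ (b :+ t :* y)) refl a b t (evalP p t) (evalP q t))

evalP-negP : ∀ p t → evalP (negP p) t ≡ ℚ.- evalP p t
evalP-negP []      t = refl
evalP-negP (a ∷ p) t = trans (cong (λ x → ℚ.- a ℚ.+ t ℚ.* x) (evalP-negP p t))
  (solve 3 (λ a t x → (:- a) :+ t :* (:- x) := :- (a :+ t :* x)) refl a t (evalP p t))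

evalP-scale : ∀ c p t → evalP (List.map (c ℚ.*_) p) t ≡ c ℚ.* evalP p t
evalP-scale c []      t = sym (ℚP.*-zeroʳ c)
evalP-scale c (a ∷ p) t = trans (cong (λ x → c ℚ.* a ℚ.+ t ℚ.* x) (evalP-scale c p t))
  (solve 4 (λ c a t x → c :* a :+ t :* (c :* x) := c :* (a :+ t :* x)) refl c a t (evalP p t))

shiftP : ℕ → Poly → Poly
shiftP K q = List.replicate K 0ℚ ++ q

coeffP-shiftP : ∀ K q {j} → K ℕ.≤ j → coeffP (shiftP K q) j ≡ coeffP q (j ℕ.∸ K)
coeffP-shiftP zero    q K≤j       = refl
coeffP-shiftP (suc K) q (s≤s K≤j) = coeffP-shiftP K q K≤j

evalP-shiftP : ∀ K q t → evalP (shiftP K q) t ≡ t ^ℚ K ℚ.* evalP q t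
evalP-shiftP zero    q t = sym (ℚP.*-identityˡ (evalP q t))
evalP-shiftP (suc K) q t = trans (cong (λ x → 0ℚ ℚ.+ t ℚ.* x) (evalP-shiftP K q t))
  (solve 3 (λ t T e → con 0ℚ :+ t :* (T :* e) := (t :* T) :* e) refl t (t ^ℚ K) (evalP q t))

leadP-shiftP : ∀ K {q l b} → LeadP q (+ l) b → LeadP (shiftP K q) (+ (K ℕ.+ l)) b
leadP-shiftP K {q} {l} (b≡ , above) =
  trans (coeffP-shiftP K q (ℕP.m≤m+n K l)) (trans (cong (coeffP q) (ℕP.m+n∸m≡n K l)) b≡) ,
  λ { j (+<+ K+l<j) → trans (coeffP-shiftP K q (K≤ K+l<j)) (above (j ℕ.∸ K) (+<+ (l< K+l<j))) }
  where
  K≤ : ∀ {j} → K ℕ.+ l ℕ.< j → K ℕ.≤ j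
  K≤ K+l<j = ℕP.≤-trans (ℕP.m≤m+n K l) (ℕP.<⇒≤ K+l<j)
  l< : ∀ {j} → K ℕ.+ l ℕ.< j → l ℕ.< j ℕ.∸ K
  l< {j} K+l<j = subst (ℕ._≤ j ℕ.∸ K) (trans (cong (ℕ._∸ K) (sym (ℕP.+-suc K l))) (ℕP.m+n∸m≡n K (suc l)))
                       (ℕP.∸-monoˡ-≤ K K+l<j)

strictSign⇒≢0 : ∀ {f} → StrictSign f → Eventually (λ t → f t ≢ 0ℚ)
strictSign⇒≢0 (inj₁ pos) = eventually-map (λ 0<f f≡0 → ℚP.<-irrefl (sym f≡0) 0<f) pos
strictSign⇒≢0 (inj₂ neg) = eventually-map (λ f<0 f≡0 → ℚP.<-irrefl f≡0 f<0) neg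

rescale-identity : ∀ p q T μ → T ℚ.* q ≢ 0ℚ
                 → p ℚ.* invℚ q ℚ.* invℚ T ≡ μ ℚ.+ (p ℚ.- μ ℚ.* (T ℚ.* q)) ℚ.* invℚ (T ℚ.* q)
rescale-identity p q T μ Tq≢0 = sym (begin
  μ ℚ.+ (p ℚ.- μ ℚ.* (T ℚ.* q)) ℚ.* invℚ (T ℚ.* q)
    ≡⟨ cong (λ x → μ ℚ.+ (p ℚ.- μ ℚ.* (T ℚ.* q)) ℚ.* x) (invℚ-* T≢0 q≢0) ⟩
  μ ℚ.+ (p ℚ.- μ ℚ.* (T ℚ.* q)) ℚ.* (invℚ T ℚ.* invℚ q)
    ≡⟨ solve 6 (λ p q T μ iT iq → μ :+ (p :- μ :* (T :* q)) :* (iT :* iq)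
                 := p :* iq :* iT :+ μ :* (con 1ℚ :- (T :* iT) :* (q :* iq))) refl p q T μ (invℚ T) (invℚ q) ⟩
  p ℚ.* invℚ q ℚ.* invℚ T ℚ.+ μ ℚ.* (1ℚ ℚ.- (T ℚ.* invℚ T) ℚ.* (q ℚ.* invℚ q))
    ≡⟨ cong₂ (λ x y → p ℚ.* invℚ q ℚ.* invℚ T ℚ.+ μ ℚ.* (1ℚ ℚ.- x ℚ.* y)) (invℚ-inverseʳ T≢0) (invℚ-inverseʳ q≢0) ⟩
  p ℚ.* invℚ q ℚ.* invℚ T ℚ.+ μ ℚ.* (1ℚ ℚ.- 1ℚ ℚ.* 1ℚ)
    ≡⟨ solve 2 (λ x μ → x :+ μ :* (con 1ℚ :- con 1ℚ :* con 1ℚ) := x) refl (p ℚ.* invℚ q ℚ.* invℚ T) μ ⟩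
  p ℚ.* invℚ q ℚ.* invℚ T ∎)
  where
  open ≡-Reasoning
  T≢0 : T ≢ 0ℚ
  T≢0 T≡0 = Tq≢0 (trans (cong (ℚ._* q) T≡0) (ℚP.*-zeroˡ q))
  q≢0 : q ≢ 0ℚ
  q≢0 q≡0 = Tq≢0 (trans (cong (T ℚ.*_) q≡0) (ℚP.*-zeroʳ T))

-- g = μ + R/S wherever S does not vanish, with deg R < deg S.
record QuotientForm (g : ℚ → ℚ) (μ : ℚ) : Set where
  field
    R S        : Poly
    n          : ℕ
    S-top≢0    : coeffP S n ≢ 0ℚ
    S-vanishes : VanishesFrom S (suc n)
    R-vanishes : VanishesFrom R n
    g≡μ+R/S    : ∀ {t} → evalP S t ≢ 0ℚ → g t ≡ μ ℚ.+ evalP R t ℚ.* invℚ (evalP S t)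

module _ {g μ} (form : QuotientForm g μ) where

  open QuotientForm form

  private
    S≢0 : Eventually (λ t → evalP S t ≢ 0ℚ)
    S≢0 = strictSign⇒≢0 (evalP-strictSign S n S-top≢0 S-vanishes)

  quotientForm⇒limit : LimAtInfty g μ
  quotientForm⇒limit ε 0<ε = eventually-map close (eventually-∧ S≢0 (quotient→0 R S n S-top≢0 S-vanishes R-vanishes ε 0<ε))
    where
    close : ∀ {t} → evalP S t ≢ 0ℚ × ℚ.∣ evalP R t ℚ.* invℚ (evalP S t) ℚ.- 0ℚ ∣ < ε → ℚ.∣ g t ℚ.- μ ∣ < ε
    close {t} (s≢0 , small) = subst (λ x → ℚ.∣ x ∣ < ε) (begin
      quot ℚ.- 0ℚ          ≡⟨ solve 2 (λ μ x → x :- con 0ℚ := μ :+ x :- μ) refl μ quot ⟩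
      μ ℚ.+ quot ℚ.- μ     ≡⟨ cong (ℚ._- μ) (g≡μ+R/S s≢0) ⟨
      g t ℚ.- μ            ∎) small
      where
      open ≡-Reasoning
      quot = evalP R t ℚ.* invℚ (evalP S t)

  quotientForm⇒sign : Eventually (λ t → μ ≤ g t) ⊎ Eventually (λ t → g t ≤ μ)
  quotientForm⇒sign with weakSign-quotient (evalP-weakSign R) (evalP-strictSign S n S-top≢0 S-vanishes)
  ... | inj₁ quot≥0 = inj₁ (eventually-map (λ (s≢0 , 0≤quot) → subst₂ _≤_ (ℚP.+-identityʳ μ) (sym (g≡μ+R/S s≢0))
                                                                  (ℚP.+-monoʳ-≤ μ 0≤quot)) (eventually-∧ S≢0 quot≥0))
  ... | inj₂ quot≤0 = inj₂ (eventually-map (λ (s≢0 , quot≤0) → subst₂ _≤_ (sym (g≡μ+R/S s≢0)) (ℚP.+-identityʳ μ)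
                                                                  (ℚP.+-monoʳ-≤ μ quot≤0)) (eventually-∧ S≢0 quot≤0))

-- For ρ = P/Q = μ·tᴷ + lower order take S = tᴷ·Q and R = P − μ·S.
leadR⇒quotientForm : ∀ {ρ K μ} → LeadR ρ (+ K) μ → QuotientForm (λ t → evalR ρ t ℚ.* invℚ (t ^ℚ K)) μ
leadR⇒quotientForm {P ⁄ Q} {K} {μ} (leadR l b tq lp) = record
  { R = R ; S = S ; n = K ℕ.+ l
  ; S-top≢0    = λ Sn≡0 → proj₂ (topP⇒leadP Q tq) (trans (sym (proj₁ leadS)) Sn≡0)
  ; S-vanishes = λ j n<j → proj₂ leadS j (+<+ n<j)
  ; R-vanishes = R-vanishes
  ; g≡μ+R/S    = g≡μ+R/S
  }
  where
  S = shiftP K Q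
  R = addP P (negP (List.map (μ ℚ.*_) S))
  leadS = leadP-shiftP K (proj₁ (topP⇒leadP Q tq))
  leadR0 : LeadP R (+ (K ℕ.+ l)) 0ℚ
  leadR0 = subst (LeadP R _) (ℚP.+-inverseʳ (μ ℚ.* b))
             (leadP-addP {p = P} lp (leadP-negP {p = List.map (μ ℚ.*_) S} (leadP-scale μ {p = S} leadS)))
  R-vanishes : VanishesFrom R (K ℕ.+ l)
  R-vanishes j n≤j with ℕP.m≤n⇒m<n∨m≡n n≤j
  ... | inj₁ n<j  = proj₂ leadR0 j (+<+ n<j)
  ... | inj₂ refl = proj₁ leadR0
  g≡μ+R/S : ∀ {t} → evalP S t ≢ 0ℚ → evalR (P ⁄ Q) t ℚ.* invℚ (t ^ℚ K) ≡ μ ℚ.+ evalP R t ℚ.* invℚ (evalP S t)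
  g≡μ+R/S {t} s≢0 = begin
    evalP P t ℚ.* invℚ q ℚ.* invℚ T
      ≡⟨ rescale-identity (evalP P t) q T μ (λ Tq≡0 → s≢0 (trans s≡Tq Tq≡0)) ⟩
    μ ℚ.+ (evalP P t ℚ.- μ ℚ.* (T ℚ.* q)) ℚ.* invℚ (T ℚ.* q)
      ≡⟨ cong₂ (λ r s → μ ℚ.+ r ℚ.* invℚ s) (sym r≡) (sym s≡Tq) ⟩
    μ ℚ.+ evalP R t ℚ.* invℚ (evalP S t)
      ∎
    where
    open ≡-Reasoning
    T = t ^ℚ K
    q = evalP Q t
    s≡Tq = evalP-shiftP K Q t
    r≡ : evalP R t ≡ evalP P t ℚ.- μ ℚ.* (T ℚ.* q)
    r≡ = trans (evalP-addP P _ t) (cong (evalP P t ℚ.+_)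
           (trans (evalP-negP (List.map (μ ℚ.*_) S) t) (cong ℚ.-_ (trans (evalP-scale μ S t) (cong (μ ℚ.*_) s≡Tq)))))

lemma3p9 : ∀ {m n : ℕ} (f : Vec (Vec RatFun m) n)
  → (∀ i k → WellFormed (lookup (lookup f i) k))
  → (d : Fin n → ℤ)
  → (∀ i → degV (lookup f i) ≡ just (d i))
  → (∀ i j → i Fin.≤ j → d i ℤ.≤ d j)
  → LinIndepℚ (Vec.map pilot f)
  → (∀ i → degV (lookup (GSR.gsVecs f) i) ≡ just (d i))
    × (∀ i j → j Fin.< i →
         LimAtInfty (λ t → evalR (GSR.gsCoeff f i j) t ℚ.* invℚ (t ^ℚ ∣ d i ℤ.- d j ∣))
                    (GSℚ.gsCoeff (Vec.map pilot f) i j))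
    × (∀ i j → j Fin.< i →
         Eventually (λ t → GSℚ.gsCoeff (Vec.map pilot f) i j ≤ evalR (GSR.gsCoeff f i j) t ℚ.* invℚ (t ^ℚ ∣ d i ℤ.- d j ∣))
         ⊎ Eventually (λ t → evalR (GSR.gsCoeff f i j) t ℚ.* invℚ (t ^ℚ ∣ d i ℤ.- d j ∣) ≤ GSℚ.gsCoeff (Vec.map pilot f) i j))
    × (∀ i → pilot (lookup (GSR.gsVecs f) i) ≡ lookup (GSℚ.gsVecs (Vec.map pilot f)) i)
lemma3p9 {m} f wf d deg≡ d-mono indep = degrees , limits , signs , pilots
  where
  P = Vec.map pilot f
  leadF : ∀ i → LeadV (lookup f i) (d i) (lookup P i)
  leadF i = subst (LeadV (lookup f i) (d i)) (sym (VecP.lookup-map i pilot f)) (degV⇒leadV (lookup f i) (wf i) (deg≡ i))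
  nondeg = gsVecs-nondegenerate P indep
  leadGS : ∀ i → LeadV (lookup (GSR.gsVecs f) i) (d i) (lookup (GSℚ.gsVecs P) i)
  leadGS = leadV-go f P d ListPW.[] leadF nondeg
  nonzero : ∀ i → lookup (GSℚ.gsVecs P) i ≢ replicate m 0ℚ
  nonzero i w≡0 = nondeg i (trans (cong (λ w → GSℚ.dot w w) w≡0) (dot-0ᵥ {m}))
  leadρ : ∀ i j → j Fin.< i → LeadR (GSR.gsCoeff f i j) (+ ∣ d i ℤ.- d j ∣) (GSℚ.gsCoeff P i j)
  leadρ i j j<i = subst (λ z → LeadR (GSR.gsCoeff f i j) z (GSℚ.gsCoeff P i j))
    (sym (ℤP.0≤i⇒+∣i∣≡i (ℤP.i≤j⇒0≤j-i (d-mono j i (ℕP.<⇒≤ j<i)))))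
    (leadR-coeff (leadF i) (leadGS j) (nondeg j))
  degrees = λ i → leadV⇒degV (leadGS i) (nonzero i)
  pilots = λ i → leadV⇒pilot (leadGS i) (nonzero i)
  limits = λ i j j<i → quotientForm⇒limit (leadR⇒quotientForm (leadρ i j j<i))
  signs = λ i j j<i → quotientForm⇒sign (leadR⇒quotientForm (leadρ i j j<i))
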